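{- Let $q$ be a prime power and $h,k$ integers with $4\le h\le k$. Let $1\le s\le h$, let $i_1<\dots<i_s$ be indices in $\{1,\dots,h\}$, and let $a_{i_1},\dots,a_{i_s}\in\mathbb{F}_q^*$. Suppose that the values $a_{i_1},\dots,a_{i_s}$ comprise exactly $l$ distinct elements of $\mathbb{F}_q^*$, occurring with multiplicities $r_1,\dots,r_l\ge1$ (so $r_1+\dots+r_l=s$). Let $\Lambda$ be the number of $(x_1,\dots,x_k)\in\mathbb{F}_q^k$ satisfying simultaneously $$a_{i_1}x_{i_1}+\dots+a_{i_s}x_{i_s}=0\quad\text{and}\quad (x_1+\dots+x_h)\,x_1\cdots x_h=0.$$ Then $$\Lambda=q^{k-1}-(q-1)^{h-s}q^{k-h}\psi_s+q^{k-h}A_{r_1,\dots,r_l,h-s}.$$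
   Context: For $m\ge 0$, $\psi_m$ is the number of $(y_1,\dots,y_m)\in\mathbb{F}_q^m$ with $\sum y_i=0$ and all $y_i\neq0$ ($\psi_0=1$), and $\varphi_m$ is the number of $(y_1,\dots,y_m)\in\mathbb{F}_q^m$ with $\sum y_i=1$ and all $y_i\neq 0$ ($\varphi_0=0$). For positive integers $r_1,\dots,r_l$ define recursively $A_{r_1}=\psi_{r_1}$ and, for $l\ge2$, $A_{r_1,\dots,r_l}=\psi_{r_1+\dots+r_{l-1}}\varphi_{r_l}+(-1)^{r_l}A_{r_1,\dots,r_{l-1}}$. Convention: $A_{r_1,\dots,r_l,0}:=A_{r_1,\dots,r_l}$; and for $t\ge1$, $A_{r_1,\dots,r_l,t}$ is given by the same recursion, i.e. $\psi_{r_1+\dots+r_l}\varphi_t+(-1)^tA_{r_1,\dots,r_l}$. -}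

module Defs where

open import Level using (0ℓ)
open import Data.Nat as ℕ using (ℕ; zero; suc; _∸_)
open import Data.Nat.Primality using (Prime)
open import Data.Fin as Fin using (Fin; inject≤)
open import Data.List as List using (List; []; _∷_)
open import Data.Nat.ListAction using (sum)
open import Data.Vec as Vec using (Vec; []; _∷_)
open import Data.Bool using (Bool; true; false; if_then_else_; _∧_)
open import Data.Integer as ℤ using (ℤ; +_)
open import Data.Product using (∃; ∃-syntax; _×_; _,_)
open import Relation.Nullary using (¬_; Dec; yes; no)
open import Relation.Nullary.Decidable using (⌊_⌋)
open import Relation.Binary using (DecidableEquality)
open import Relation.Binary.PropositionalEquality using (_≡_)
open import Algebra.Structures using (IsCommutativeRing)
open import Function.Bundles using (_↔_; Inverse)

IsPrimePower : ℕ → Set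
IsPrimePower q = ∃[ p ] ∃[ e ] (Prime p × q ≡ p ℕ.^ suc e)

record FiniteField : Set₁ where
  infixl 6 _+_
  infixl 7 _*_
  field
    Carrier : Set
    _+_ _*_ : Carrier → Carrier → Carrier
    -_ : Carrier → Carrier
    0# 1# : Carrier
    isCommutativeRing : IsCommutativeRing _≡_ _+_ _*_ -_ 0# 1#
    0≢1 : ¬ (0# ≡ 1#)
    inverse : ∀ x → ¬ (x ≡ 0#) → ∃[ y ] (x * y ≡ 1#)
    _≟_ : DecidableEquality Carrier
    size : ℕ
    enum : Fin size ↔ Carrier

module _ (F : FiniteField) where
  open FiniteField F

  elements : List Carrier
  elements = List.map (Inverse.to enum) (List.allFin size)

  countVec : (m : ℕ) → (Vec Carrier m → Bool) → ℕ
  countVec zero P = if P [] then 1 else 0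
  countVec (suc m) P = sum (List.map (λ c → countVec m (λ v → P (c ∷ v))) elements)

  Σᶠ : (n : ℕ) → (Fin n → Carrier) → Carrier
  Σᶠ zero f = 0#
  Σᶠ (suc n) f = f Fin.zero + Σᶠ n (λ i → f (Fin.suc i))

  Πᶠ : (n : ℕ) → (Fin n → Carrier) → Carrier
  Πᶠ zero f = 1#
  Πᶠ (suc n) f = f Fin.zero * Πᶠ n (λ i → f (Fin.suc i))

  allNonzero : ∀ {m} → Vec Carrier m → Bool
  allNonzero [] = true
  allNonzero (y ∷ ys) = (if ⌊ y ≟ 0# ⌋ then false else true) ∧ allNonzero ys

  ψ : ℕ → ℕ
  ψ m = countVec m (λ y → ⌊ Vec.foldr _ _+_ 0# y ≟ 0# ⌋ ∧ allNonzero y)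

  φ : ℕ → ℕ
  φ m = countVec m (λ y → ⌊ Vec.foldr _ _+_ 0# y ≟ 1# ⌋ ∧ allNonzero y)

  sgn : ℕ → ℤ
  sgn r = (ℤ.- (+ 1)) ℤ.^ r

  -- A on the REVERSED list (r_l ∷ r_{l-1} ∷ … ∷ r_1):
  --   A_{r_1} = ψ_{r_1},
  --   A_{r_1..r_l} = ψ_{r_1+…+r_{l-1}} φ_{r_l} + (-1)^{r_l} A_{r_1..r_{l-1}}.
  -- (the empty list never occurs in the statement; its value is irrelevant)
  Arev : List ℕ → ℤ
  Arev [] = + 0
  Arev (r ∷ []) = + ψ r
  Arev (r ∷ r' ∷ rest) =
    (+ (ψ (sum (r' ∷ rest)) ℕ.* φ r)) ℤ.+ sgn r ℤ.* Arev (r' ∷ rest)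

  A : List ℕ → ℤ
  A rs = Arev (List.reverse rs)

  -- A_{r_1,…,r_l,t} with the convention A_{…,0} = A_{…}
  Aext : List ℕ → ℕ → ℤ
  Aext rs zero = A rs
  Aext rs (suc t) = (+ (ψ (sum rs) ℕ.* φ (suc t))) ℤ.+ sgn (suc t) ℤ.* A rs

  Λ : (k h : ℕ) → h ℕ.≤ k → (s : ℕ) → (Fin s → Fin h) → (Fin s → Carrier) → ℕ
  Λ k h h≤k s idx a = countVec k (λ x →
      ⌊ Σᶠ s (λ t → a t * Vec.lookup x (inject≤ (idx t) h≤k)) ≟ 0# ⌋
    ∧ ⌊ (Σᶠ h (λ i → Vec.lookup x (inject≤ i h≤k))
          * Πᶠ h (λ i → Vec.lookup x (inject≤ i h≤k))) ≟ 0# ⌋)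

  mult : (s : ℕ) → (Fin s → Carrier) → Carrier → ℕ
  mult s a b = List.length (List.filter (λ t → a t ≟ b) (List.allFin s))

module Submission where

-- Only the first h coordinates are constrained, so Λ = q^{k-h} Λ_h, where Λ_h counts
-- y ∈ F^h with L(y) = 0 and (Σ y)·Π y = 0, for L(y) = Σ_i c_i y_i with c_{i_t} = a_t and
-- c_i = 0 elsewhere.  As Π y = 0 iff some y_i = 0, by inclusion–exclusion
--   Λ_h = #{L = 0} - #{L = 0, y ∈ F*^h} + #{L = 0, Σ y = 0, y ∈ F*^h}.
-- The counts are computed by recursion on the list c, as sums over F and F* that are
-- invariant under x ↦ d - x and x ↦ u x (u ≠ 0).  With D_r(δ) = #{y ∈ F*^r : Σ y = δ},
-- so that ψ_r = D_r(0) and φ_r = D_r(1): the first count is q^{h-1} (some c_i ≠ 0), the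
-- second is (q-1)^{h-s} D_s(0).  The third, N(c), depends only on the multiset c, and
-- translating a value g of multiplicity r to 0 gives N(g^r d) = ψ_{|d|} φ_r + (-1)^r N(d)
-- for g ∉ d, since D_r(0) = D_r(1) + (-1)^r.

open import Defs
open import Level using (0ℓ)
open import Data.Nat as ℕ using (ℕ; zero; suc; _+_; _*_; _∸_; _^_; _≤_)
import Data.Nat.Properties as ℕP
open import Data.Fin as Fin using (Fin)
import Data.Fin.Properties as FinP
open import Data.List as List using (List; []; _∷_; _++_)
import Data.List.Properties as ListP
open import Data.List.Relation.Unary.Any using (Any; here; there)
import Data.List.Relation.Unary.Any.Properties as AnyP
import Data.List.Relation.Unary.All as All
open import Data.List.Membership.Propositional using (_∈_)
import Data.List.Membership.Propositional.Properties as ∈P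
open import Data.List.Relation.Unary.Unique.Propositional using (Unique)
open import Data.List.Relation.Unary.AllPairs using ([]; _∷_)
import Data.List.Relation.Binary.Permutation.Propositional.Properties as PermP
import Data.List.Relation.Binary.Permutation.Setoid as PermSetoid
import Data.List.Relation.Binary.Permutation.Setoid.Properties as PermSetoidP
import Data.List.Relation.Unary.Unique.Propositional.Properties as UniqueP
import Data.List.Relation.Unary.All.Properties as AllP
import Data.Nat.ListAction.Properties as NatListP
open import Data.List.Relation.Binary.Permutation.Propositional as Perm using (_↭_)
open import Data.Nat.ListAction using (sum)
open import Data.Vec as Vec using (Vec; []; _∷_)
import Data.Vec.Properties as VecP
open import Data.Vec.Functional using (toList)
open import Data.Bool using (Bool; true; false; if_then_else_; _∧_; _∨_; not)
open import Data.Bool.Properties using (∧-zeroʳ; ∧-identityʳ)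
open import Data.Integer as ℤ using (ℤ; +_)
import Data.Integer.Properties as ℤP
open import Data.Product using (∃-syntax; _×_; _,_; proj₁; proj₂)
open import Data.Sum using (_⊎_; inj₁; inj₂)
open import Data.Empty using (⊥; ⊥-elim)
open import Data.Integer.Tactic.RingSolver using (solve-∀)
open import Relation.Nullary using (¬_; Dec; yes; no)
open import Relation.Nullary.Decidable using (⌊_⌋; isYes≗does; dec-true; dec-false; does-⇔)
open import Relation.Binary.PropositionalEquality
open import Relation.Binary.Definitions using (tri<; tri≈; tri>)
open import Function using (_∘_; _↔_; Inverse; mk↔ₛ′; mk⇔)
open import Function.Definitions using (Injective)
open import Algebra.Bundles using (Monoid; CommutativeRing)
import Algebra.Properties.Monoid.Sum as MonoidSum
import Algebra.Properties.Semiring.Sum as SemiringSum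
import Algebra.Properties.Group as GroupProps
import Algebra.Properties.AbelianGroup as AbelianGroupProps
import Algebra.Properties.CommutativeSemigroup as CommSemigroupProps
import Algebra.Properties.Ring as RingProps

⌊⌋-yes : {P : Set} (p : Dec P) → P → ⌊ p ⌋ ≡ true
⌊⌋-yes p x = trans (isYes≗does p) (dec-true p x)

⌊⌋-no : {P : Set} (p : Dec P) → ¬ P → ⌊ p ⌋ ≡ false
⌊⌋-no p ¬x = trans (isYes≗does p) (dec-false p ¬x)

⌊⌋-⇔ : {P Q : Set} (p : Dec P) (q : Dec Q) → (P → Q) → (Q → P) → ⌊ p ⌋ ≡ ⌊ q ⌋
⌊⌋-⇔ p q to from = trans (isYes≗does p) (trans (does-⇔ (mk⇔ to from) p q) (sym (isYes≗does q)))

ι : Bool → ℕ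
ι b = if b then 1 else 0

module SingleTerm {c ℓ} (M : Monoid c ℓ) where
  open Monoid M using (Carrier; _≈_; ∙-cong; ∙-congˡ; identityˡ; identityʳ)
    renaming (ε to 0ᴹ; trans to ≈-trans)
  open MonoidSum M using (sum-cong-≋; sum-replicate-zero) renaming (sum to ∑ᴹ)

  ∑-single : ∀ {n} (j : Fin n) (f : Fin n → Carrier) →
             (∀ i → ¬ (i ≡ j) → f i ≈ 0ᴹ) → ∑ᴹ f ≈ f j
  ∑-single {suc n} Fin.zero f off =
    ≈-trans (∙-congˡ (≈-trans (sum-cong-≋ (λ i → off (Fin.suc i) (λ ()))) (sum-replicate-zero n)))
          (identityʳ (f Fin.zero))
  ∑-single {suc n} (Fin.suc j) f off =
    ≈-trans (∙-cong (off Fin.zero (λ ())) (∑-single j (λ i → f (Fin.suc i))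
                    (λ i i≢j → off (Fin.suc i) (λ e → i≢j (FinP.suc-injective e)))))
          (identityˡ (f (Fin.suc j)))

module ℕSum = SemiringSum ℕP.+-*-semiring
open ℕSum using (sum-cong-≗; ∑-distrib-+; ∑-comm; *-distribˡ-sum; sum-permute) renaming (sum to ∑)
open SingleTerm ℕP.+-0-monoid using (∑-single)

∑-const : ∀ n k → ∑ {n} (λ _ → k) ≡ n * k
∑-const zero k = refl
∑-const (suc n) k = cong (_+_ k) (∑-const n k)

sum-allFin : ∀ n (f : Fin n → ℕ) → sum (List.map f (List.allFin n)) ≡ ∑ f
sum-allFin n f = trans (cong sum (ListP.map-tabulate (λ i → i) f)) (sum-tabulate n f)
  where
  sum-tabulate : ∀ n (f : Fin n → ℕ) → sum (List.tabulate f) ≡ ∑ f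
  sum-tabulate zero f = refl
  sum-tabulate (suc n) f = cong (_+_ (f Fin.zero)) (sum-tabulate n (λ i → f (Fin.suc i)))

∑-select : ∀ {n} (j : Fin n) (f : Fin n → ℕ) → ∑ (λ i → if ⌊ i FinP.≟ j ⌋ then f i else 0) ≡ f j
∑-select j f = trans (∑-single j _ off) (cong (λ b → if b then f j else 0) (⌊⌋-yes (j FinP.≟ j) refl))
  where
  off : ∀ i → ¬ (i ≡ j) → (if ⌊ i FinP.≟ j ⌋ then f i else 0) ≡ 0
  off i i≢j rewrite ⌊⌋-no (i FinP.≟ j) i≢j = refl

Unique-reverse : ∀ {A : Set} (xs : List A) → Unique xs → Unique (List.reverse xs)
Unique-reverse {A} xs = Unique-resp-↭ (↭ₛ-sym (↭ₛ-reverse xs))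
  where
  open PermSetoid (setoid A) using () renaming (↭-sym to ↭ₛ-sym)
  open PermSetoidP (setoid A) using (Unique-resp-↭) renaming (↭-reverse to ↭ₛ-reverse)

sum-reverse : ∀ xs → sum (List.reverse xs) ≡ sum xs
sum-reverse xs = NatListP.sum-↭ (PermP.↭-reverse xs)

module Counting (F : FiniteField) where
  open FiniteField F renaming (Carrier to C; _+_ to _⊕_; _*_ to _⊗_; -_ to ⊖_)

  private
    fieldRing : CommutativeRing 0ℓ 0ℓ
    fieldRing = record { isCommutativeRing = isCommutativeRing }
    module R = CommutativeRing fieldRing
    module +G = GroupProps R.+-group
    module +AG = AbelianGroupProps R.+-abelianGroup
    module +CS = CommSemigroupProps R.+-commutativeSemigroup
    module *CS = CommSemigroupProps R.*-commutativeSemigroup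
    module RP = RingProps R.ring
    module FΣ = SemiringSum R.semiring
    open SingleTerm R.+-monoid using () renaming (∑-single to ∑ᶠ-single)

  q : ℕ
  q = size

  infixl 6 _⊝_
  _⊝_ : C → C → C
  x ⊝ y = x ⊕ ⊖ y

  ⊝-self : ∀ x → x ⊝ x ≡ 0#
  ⊝-self = R.-‿inverseʳ

  ⊝-identityʳ : ∀ x → x ⊝ 0# ≡ x
  ⊝-identityʳ x = trans (cong (x ⊕_) +G.ε⁻¹≈ε) (R.+-identityʳ x)

  ⊝-0⊗ : ∀ a x → a ⊝ 0# ⊗ x ≡ a
  ⊝-0⊗ a x = trans (cong (a ⊝_) (R.zeroˡ x)) (⊝-identityʳ a)

  ⊝⊕-cancel : ∀ d x → x ⊝ d ⊕ d ≡ x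
  ⊝⊕-cancel = +G.//-rightDividesˡ

  ⊕⊝-cancel : ∀ d x → x ⊕ d ⊝ d ≡ x
  ⊕⊝-cancel = +G.//-rightDividesʳ

  ⊕-⊝-inverse : ∀ a α → a ⊕ (α ⊝ a) ≡ α
  ⊕-⊝-inverse a α = trans (R.+-comm a (α ⊝ a)) (⊝⊕-cancel a α)

  ⊝-involutive : ∀ d x → d ⊝ (d ⊝ x) ≡ x
  ⊝-involutive d x = trans (cong (d ⊕_) (+AG.⁻¹-anti-homo‿- d x)) (⊕-⊝-inverse d x)

  ⊝-swap : ∀ a b c → a ⊝ b ⊝ c ≡ a ⊝ c ⊝ b
  ⊝-swap a b c = +CS.xy∙z≈xz∙y a (⊖ b) (⊖ c)

  ⊝-interchange : ∀ a b c d → a ⊝ b ⊝ (c ⊝ d) ≡ a ⊝ c ⊝ (b ⊝ d)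
  ⊝-interchange a b c d = begin
    a ⊝ b ⊕ ⊖ (c ⊝ d)        ≡⟨ cong (a ⊝ b ⊕_) (sym (+AG.⁻¹-∙-comm c (⊖ d))) ⟩
    a ⊝ b ⊕ (⊖ c ⊕ ⊖ (⊖ d)) ≡⟨ +CS.interchange a (⊖ b) (⊖ c) (⊖ (⊖ d)) ⟩
    a ⊝ c ⊕ (⊖ b ⊕ ⊖ (⊖ d)) ≡⟨ cong (a ⊝ c ⊕_) (+AG.⁻¹-∙-comm b (⊖ d)) ⟩
    a ⊝ c ⊕ ⊖ (b ⊝ d)        ∎
    where open ≡-Reasoning

  ⊗-distrib-⊝ : ∀ u β x → u ⊗ (β ⊝ x) ≡ u ⊗ β ⊝ u ⊗ x
  ⊗-distrib-⊝ = RP.x[y-z]≈xy-xz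

  scale-form : ∀ u α c x → u ⊗ α ⊝ c ⊗ (u ⊗ x) ≡ u ⊗ (α ⊝ c ⊗ x)
  scale-form u α c x = trans (cong (u ⊗ α ⊝_) (*CS.x∙yz≈y∙xz c u x)) (sym (⊗-distrib-⊝ u α (c ⊗ x)))

  -- Shifting every coefficient by -l and the target by -l·β, when Σ x = β.
  translate-form : ∀ α l β c x → α ⊝ l ⊗ β ⊝ (c ⊝ l) ⊗ x ≡ α ⊝ c ⊗ x ⊝ l ⊗ (β ⊝ x)
  translate-form α l β c x = begin
    α ⊝ l ⊗ β ⊝ (c ⊝ l) ⊗ x       ≡⟨ cong (α ⊝ l ⊗ β ⊝_) (RP.[y-z]x≈yx-zx x c l) ⟩
    α ⊝ l ⊗ β ⊝ (c ⊗ x ⊝ l ⊗ x)   ≡⟨ ⊝-interchange α (l ⊗ β) (c ⊗ x) (l ⊗ x) ⟩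
    α ⊝ c ⊗ x ⊝ (l ⊗ β ⊝ l ⊗ x)   ≡⟨ cong (α ⊝ c ⊗ x ⊝_) (sym (⊗-distrib-⊝ l β x)) ⟩
    α ⊝ c ⊗ x ⊝ l ⊗ (β ⊝ x)       ∎
    where open ≡-Reasoning

  0⊝⊗0 : ∀ g → 0# ⊝ g ⊗ 0# ≡ 0#
  0⊝⊗0 g = trans (cong (0# ⊝_) (R.zeroʳ g)) (⊝-identityʳ 0#)

  ⊕≡-move : ∀ a u α → ⌊ (a ⊕ u) ≟ α ⌋ ≡ ⌊ u ≟ (α ⊝ a) ⌋
  ⊕≡-move a u α = ⌊⌋-⇔ ((a ⊕ u) ≟ α) (u ≟ (α ⊝ a))
    (λ e → trans (sym (⊕⊝-cancel a u)) (cong (_⊝ a) (trans (R.+-comm u a) e)))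
    (λ e → trans (cong (a ⊕_) e) (⊕-⊝-inverse a α))

  ⊝≡0⇒≡ : ∀ a b → a ⊝ b ≡ 0# → a ≡ b
  ⊝≡0⇒≡ = +G.x∙y⁻¹≈ε⇒x≈y

  ≟-sym : ∀ x y → ⌊ x ≟ y ⌋ ≡ ⌊ y ≟ x ⌋
  ≟-sym x y = ⌊⌋-⇔ (x ≟ y) (y ≟ x) sym sym

  inv : ∀ u → ¬ (u ≡ 0#) → C
  inv u u≢0 = proj₁ (inverse u u≢0)

  inv-cancel : ∀ u (u≢0 : ¬ (u ≡ 0#)) x → inv u u≢0 ⊗ (u ⊗ x) ≡ x
  inv-cancel u u≢0 x = begin
    inv u u≢0 ⊗ (u ⊗ x) ≡⟨ sym (R.*-assoc _ u x) ⟩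
    inv u u≢0 ⊗ u ⊗ x   ≡⟨ cong (_⊗ x) (trans (R.*-comm _ u) (proj₂ (inverse u u≢0))) ⟩
    1# ⊗ x              ≡⟨ R.*-identityˡ x ⟩
    x                   ∎
    where open ≡-Reasoning

  inv-cancelʳ : ∀ u (u≢0 : ¬ (u ≡ 0#)) x → u ⊗ (inv u u≢0 ⊗ x) ≡ x
  inv-cancelʳ u u≢0 x = trans (sym (R.*-assoc u _ x))
    (trans (cong (_⊗ x) (proj₂ (inverse u u≢0))) (R.*-identityˡ x))

  ⊗≟0 : ∀ u x → ¬ (u ≡ 0#) → ⌊ (u ⊗ x) ≟ 0# ⌋ ≡ ⌊ x ≟ 0# ⌋
  ⊗≟0 u x u≢0 = ⌊⌋-⇔ ((u ⊗ x) ≟ 0#) (x ≟ 0#)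
    (λ e → trans (sym (inv-cancel u u≢0 x)) (trans (cong (inv u u≢0 ⊗_) e) (R.zeroʳ _)))
    (λ e → trans (cong (u ⊗_) e) (R.zeroʳ u))

  ⊗≟0-∨ : ∀ u x → ⌊ (u ⊗ x) ≟ 0# ⌋ ≡ (⌊ u ≟ 0# ⌋ ∨ ⌊ x ≟ 0# ⌋)
  ⊗≟0-∨ u x with u ≟ 0#
  ... | yes refl = ⌊⌋-yes ((0# ⊗ x) ≟ 0#) (R.zeroˡ x)
  ... | no u≢0 = ⊗≟0 u x u≢0

  to : Fin q → C
  to = Inverse.to enum

  from : C → Fin q
  from = Inverse.from enum

  to-from : ∀ x → to (from x) ≡ x
  to-from = Inverse.strictlyInverseˡ enum

  onUnits : (C → ℕ) → C → ℕ
  onUnits f x = if ⌊ x ≟ 0# ⌋ then 0 else f x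

  opaque
    S : (C → ℕ) → ℕ
    S f = ∑ (f ∘ to)

    S-cong : ∀ {f g : C → ℕ} → (∀ x → f x ≡ g x) → S f ≡ S g
    S-cong e = sum-cong-≗ (e ∘ to)

    S-+ : ∀ (f g : C → ℕ) → S (λ x → f x + g x) ≡ S f + S g
    S-+ f g = ∑-distrib-+ (f ∘ to) (g ∘ to)

    S-* : ∀ k (f : C → ℕ) → S (λ x → k * f x) ≡ k * S f
    S-* k f = sym (*-distribˡ-sum k (f ∘ to))

    S-const : ∀ k → S (λ _ → k) ≡ q * k
    S-const = ∑-const q

    S-swap : ∀ (f : C → C → ℕ) → S (λ x → S (f x)) ≡ S (λ y → S (λ x → f x y))
    S-swap f = ∑-comm (λ i j → f (to i) (to j))

    S-single : ∀ c (f : C → ℕ) → (∀ x → ¬ (x ≡ c) → f x ≡ 0) → S f ≡ f c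
    S-single c f off = trans (∑-single (from c) (f ∘ to) off′) (cong f (to-from c))
      where
      off′ : ∀ i → ¬ (i ≡ from c) → f (to i) ≡ 0
      off′ i i≢ = off (to i) (λ e → i≢ (trans (sym (Inverse.strictlyInverseʳ enum i)) (cong from e)))

    S-select : ∀ c (f : C → ℕ) → S (λ x → if ⌊ x ≟ c ⌋ then f x else 0) ≡ f c
    S-select c f = trans (S-single c _ off) (cong (λ b → if b then f c else 0) (⌊⌋-yes (c ≟ c) refl))
      where
      off : ∀ x → ¬ (x ≡ c) → (if ⌊ x ≟ c ⌋ then f x else 0) ≡ 0
      off x x≢c rewrite ⌊⌋-no (x ≟ c) x≢c = refl

    S-bij : ∀ (g g⁻¹ : C → C) → (∀ x → g (g⁻¹ x) ≡ x) → (∀ x → g⁻¹ (g x) ≡ x) →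
            ∀ (f : C → ℕ) → S (λ x → f (g x)) ≡ S f
    S-bij g g⁻¹ gg⁻¹ g⁻¹g f =
      sym (trans (sum-permute (f ∘ to) π) (sum-cong-≗ (λ i → cong f (to-from (g (to i))))))
      where
      conj : (C → C) → Fin q → Fin q
      conj k i = from (k (to i))
      conj-inverse : ∀ {k k′ : C → C} → (∀ x → k (k′ x) ≡ x) → ∀ i → conj k (conj k′ i) ≡ i
      conj-inverse {k} {k′} kk′ i = trans (cong (from ∘ k) (to-from _))
        (trans (cong from (kk′ (to i))) (Inverse.strictlyInverseʳ enum i))
      π : Fin q ↔ Fin q
      π = mk↔ₛ′ (conj g) (conj g⁻¹) (conj-inverse {g} {g⁻¹} gg⁻¹) (conj-inverse {g⁻¹} {g} g⁻¹g)

    S-transl : ∀ d (f : C → ℕ) → S (λ x → f (d ⊝ x)) ≡ S f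
    S-transl d = S-bij (d ⊝_) (d ⊝_) (⊝-involutive d) (⊝-involutive d)

    S-shift : ∀ d (f : C → ℕ) → S (λ x → f (x ⊝ d)) ≡ S f
    S-shift d = S-bij (_⊝ d) (_⊕ d) (⊕⊝-cancel d) (⊝⊕-cancel d)

    S-scale : ∀ u → ¬ (u ≡ 0#) → ∀ (f : C → ℕ) → S (λ x → f (u ⊗ x)) ≡ S f
    S-scale u u≢0 = S-bij (u ⊗_) (inv u u≢0 ⊗_) (inv-cancelʳ u u≢0) (inv-cancel u u≢0)

    S* : (C → ℕ) → ℕ
    S* f = S (onUnits f)

    S*-def : ∀ f → S* f ≡ S (onUnits f)
    S*-def f = refl

    S-split0 : ∀ (f : C → ℕ) → S f ≡ f 0# + S* f
    S-split0 f = begin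
      S f                                                        ≡⟨ S-cong split ⟩
      S (λ x → (if ⌊ x ≟ 0# ⌋ then f x else 0) + onUnits f x) ≡⟨ S-+ (λ x → if ⌊ x ≟ 0# ⌋ then f x else 0) (onUnits f) ⟩
      S (λ x → if ⌊ x ≟ 0# ⌋ then f x else 0) + S* f           ≡⟨ cong (_+ S* f) (S-select 0# f) ⟩
      f 0# + S* f                                                ∎
      where
      open ≡-Reasoning
      split : ∀ x → f x ≡ (if ⌊ x ≟ 0# ⌋ then f x else 0) + onUnits f x
      split x with ⌊ x ≟ 0# ⌋
      ... | true = sym (ℕP.+-identityʳ (f x))
      ... | false = refl

    S*-cong : ∀ {f g : C → ℕ} → (∀ x → ¬ (x ≡ 0#) → f x ≡ g x) → S* f ≡ S* g
    S*-cong {f} {g} e = S-cong pointwise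
      where
      pointwise : ∀ x → onUnits f x ≡ onUnits g x
      pointwise x with x ≟ 0#
      ... | yes _ = refl
      ... | no x≢0 = e x x≢0

    S*-* : ∀ k (f : C → ℕ) → S* (λ x → k * f x) ≡ k * S* f
    S*-* k f = trans (S-cong pointwise) (S-* k (onUnits f))
      where
      pointwise : ∀ x → onUnits (λ y → k * f y) x ≡ k * onUnits f x
      pointwise x with ⌊ x ≟ 0# ⌋
      ... | true = sym (ℕP.*-zeroʳ k)
      ... | false = refl

    S*-const : ∀ k → S* (λ _ → k) ≡ (q ∸ 1) * k
    S*-const k = begin
      S* (λ _ → k)         ≡⟨ sym (ℕP.m+n∸m≡n k _) ⟩
      k + S* (λ _ → k) ∸ k ≡⟨ cong (_∸ k) (sym (S-split0 (λ _ → k))) ⟩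
      S (λ _ → k) ∸ k      ≡⟨ cong₂ _∸_ (S-const k) (sym (ℕP.*-identityˡ k)) ⟩
      q * k ∸ 1 * k        ≡⟨ sym (ℕP.*-distribʳ-∸ k q 1) ⟩
      (q ∸ 1) * k          ∎
      where open ≡-Reasoning

    S-S*-swap : ∀ (f : C → C → ℕ) → S (λ x → S* (f x)) ≡ S* (λ y → S (λ x → f x y))
    S-S*-swap f = trans (S-swap (λ x → onUnits (f x))) (S-cong pointwise)
      where
      pointwise : ∀ y → S (λ x → onUnits (f x) y) ≡ onUnits (λ y → S (λ x → f x y)) y
      pointwise y with ⌊ y ≟ 0# ⌋
      ... | true = trans (S-const 0) (ℕP.*-zeroʳ q)
      ... | false = refl

    S*-swap : ∀ (f : C → C → ℕ) → S* (λ x → S* (f x)) ≡ S* (λ y → S* (λ x → f x y))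
    S*-swap f = trans (S-cong pointwise) (S-S*-swap (λ x y → onUnits (λ x′ → f x′ y) x))
      where
      pointwise : ∀ x → onUnits (λ x′ → S* (f x′)) x ≡ S* (λ y → onUnits (λ x′ → f x′ y) x)
      pointwise x with ⌊ x ≟ 0# ⌋
      ... | true = sym (trans (S*-const 0) (ℕP.*-zeroʳ (q ∸ 1)))
      ... | false = refl

    S*-scale : ∀ u → ¬ (u ≡ 0#) → ∀ (f : C → ℕ) → S* (λ x → f (u ⊗ x)) ≡ S* f
    S*-scale u u≢0 f = trans (S-cong pointwise) (S-scale u u≢0 (onUnits f))
      where
      pointwise : ∀ x → onUnits (λ y → f (u ⊗ y)) x ≡ onUnits f (u ⊗ x)
      pointwise x rewrite ⊗≟0 u x u≢0 = refl

    countVec-suc : ∀ m (P : Vec C (suc m) → Bool) →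
                   countVec F (suc m) P ≡ S (λ c → countVec F m (λ v → P (c ∷ v)))
    countVec-suc m P = trans (cong sum (sym (ListP.map-∘ (List.allFin q)))) (sum-allFin q _)

  countVec-cong : ∀ m {P Q : Vec C m → Bool} → (∀ v → P v ≡ Q v) → countVec F m P ≡ countVec F m Q
  countVec-cong zero e = cong ι (e [])
  countVec-cong (suc m) {P} {Q} e = begin
    countVec F (suc m) P                          ≡⟨ countVec-suc m P ⟩
    S (λ c → countVec F m (λ v → P (c ∷ v)))     ≡⟨ S-cong (λ c → countVec-cong m (λ v → e (c ∷ v))) ⟩
    S (λ c → countVec F m (λ v → Q (c ∷ v)))     ≡⟨ sym (countVec-suc m Q) ⟩
    countVec F (suc m) Q                          ∎
    where open ≡-Reasoning

  countVec-const : ∀ m b → countVec F m (λ _ → b) ≡ q ^ m * ι b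
  countVec-const zero b = sym (ℕP.+-identityʳ (ι b))
  countVec-const (suc m) b = begin
    countVec F (suc m) (λ _ → b)      ≡⟨ countVec-suc m (λ _ → b) ⟩
    S (λ _ → countVec F m (λ _ → b))  ≡⟨ S-cong (λ _ → countVec-const m b) ⟩
    S (λ _ → q ^ m * ι b)             ≡⟨ S-const _ ⟩
    q * (q ^ m * ι b)                 ≡⟨ sym (ℕP.*-assoc q _ _) ⟩
    q ^ suc m * ι b                   ∎
    where open ≡-Reasoning

  countVec-add : ∀ m (P Q P′ Q′ : Vec C m → Bool) →
    (∀ v → ι (P v) + ι (Q v) ≡ ι (P′ v) + ι (Q′ v)) →
    countVec F m P + countVec F m Q ≡ countVec F m P′ + countVec F m Q′
  countVec-add zero P Q P′ Q′ e = e []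
  countVec-add (suc m) P Q P′ Q′ e = begin
    countVec F (suc m) P + countVec F (suc m) Q
      ≡⟨ cong₂ _+_ (countVec-suc m P) (countVec-suc m Q) ⟩
    S (slice P) + S (slice Q)
      ≡⟨ sym (S-+ (slice P) (slice Q)) ⟩
    S (λ c → slice P c + slice Q c)
      ≡⟨ S-cong (λ c → countVec-add m (λ v → P (c ∷ v)) (λ v → Q (c ∷ v))
                                      (λ v → P′ (c ∷ v)) (λ v → Q′ (c ∷ v)) (λ v → e (c ∷ v))) ⟩
    S (λ c → slice P′ c + slice Q′ c)
      ≡⟨ S-+ (slice P′) (slice Q′) ⟩
    S (slice P′) + S (slice Q′)
      ≡⟨ sym (cong₂ _+_ (countVec-suc m P′) (countVec-suc m Q′)) ⟩
    countVec F (suc m) P′ + countVec F (suc m) Q′ ∎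
    where
    open ≡-Reasoning
    slice : (Vec C (suc m) → Bool) → C → ℕ
    slice R c = countVec F m (λ v → R (c ∷ v))

  restrict : ∀ {h k} → h ≤ k → Vec C k → Vec C h
  restrict h≤k x = Vec.tabulate (λ i → Vec.lookup x (Fin.inject≤ i h≤k))

  countVec-restrict : ∀ h k (h≤k : h ≤ k) (P : Vec C h → Bool) →
    countVec F k (λ x → P (restrict h≤k x)) ≡ q ^ (k ∸ h) * countVec F h P
  countVec-restrict zero k h≤k P = countVec-const k (P [])
  countVec-restrict (suc h) (suc k) h≤k P = begin
    countVec F (suc k) (λ x → P (restrict h≤k x))
      ≡⟨ countVec-suc k (λ x → P (restrict h≤k x)) ⟩
    S (λ c → countVec F k (λ v → P (c ∷ restrict (ℕ.s≤s⁻¹ h≤k) v)))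
      ≡⟨ S-cong (λ c → countVec-restrict h k (ℕ.s≤s⁻¹ h≤k) (λ w → P (c ∷ w))) ⟩
    S (λ c → q ^ (k ∸ h) * countVec F h (λ w → P (c ∷ w)))
      ≡⟨ S-* (q ^ (k ∸ h)) (λ c → countVec F h (λ w → P (c ∷ w))) ⟩
    q ^ (k ∸ h) * S (λ c → countVec F h (λ w → P (c ∷ w)))
      ≡⟨ cong (q ^ (k ∸ h) *_) (sym (countVec-suc h P)) ⟩
    q ^ (k ∸ h) * countVec F (suc h) P ∎
    where open ≡-Reasoning

  -- Solution counts of a linear equation Σ c_i x_i = α, by recursion on the
  -- coefficient list c = (c_1,…,c_n):
  --   solAll c α      = #{x ∈ F^n  : Σ c_i x_i = α},
  --   solUnit c α     = #{x ∈ F*^n : Σ c_i x_i = α},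
  --   solUnitΣ c α β  = #{x ∈ F*^n : Σ c_i x_i = α and Σ x_i = β}.
  solAll : List C → C → ℕ
  solAll [] α = ι ⌊ α ≟ 0# ⌋
  solAll (c ∷ cs) α = S (λ x → solAll cs (α ⊝ c ⊗ x))

  solUnit : List C → C → ℕ
  solUnit [] α = ι ⌊ α ≟ 0# ⌋
  solUnit (c ∷ cs) α = S* (λ x → solUnit cs (α ⊝ c ⊗ x))

  solUnitΣ : List C → C → C → ℕ
  solUnitΣ [] α β = ι (⌊ α ≟ 0# ⌋ ∧ ⌊ β ≟ 0# ⌋)
  solUnitΣ (c ∷ cs) α β = S* (λ x → solUnitΣ cs (α ⊝ c ⊗ x) (β ⊝ x))

  -- D r δ = #{x ∈ F*^r : Σ x_i = δ}; so ψ_r = D r 0 and φ_r = D r 1.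
  D : ℕ → C → ℕ
  D r δ = solUnitΣ (List.replicate r 0#) 0# δ

  D-suc : ∀ r δ → D (suc r) δ ≡ S* (λ x → D r (δ ⊝ x))
  D-suc r δ = S*-cong (λ x _ → cong (λ α → solUnitΣ (List.replicate r 0#) α (δ ⊝ x)) (⊝-0⊗ 0# x))

  solUnitΣ-perm : ∀ {c d} → c ↭ d → ∀ α β → solUnitΣ c α β ≡ solUnitΣ d α β
  solUnitΣ-perm Perm.refl α β = refl
  solUnitΣ-perm (Perm.prep x p) α β = S*-cong (λ y _ → solUnitΣ-perm p _ _)
  solUnitΣ-perm {x ∷ y ∷ c} {.y ∷ .x ∷ d} (Perm.swap x y p) α β = begin
    S* (λ u → S* (λ v → solUnitΣ c (α ⊝ x ⊗ u ⊝ y ⊗ v) (β ⊝ u ⊝ v)))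
      ≡⟨ S*-swap (λ u v → solUnitΣ c (α ⊝ x ⊗ u ⊝ y ⊗ v) (β ⊝ u ⊝ v)) ⟩
    S* (λ v → S* (λ u → solUnitΣ c (α ⊝ x ⊗ u ⊝ y ⊗ v) (β ⊝ u ⊝ v)))
      ≡⟨ S*-cong (λ v _ → S*-cong (λ u _ →
           trans (cong₂ (solUnitΣ c) (⊝-swap _ _ _) (⊝-swap _ _ _)) (solUnitΣ-perm p _ _))) ⟩
    S* (λ v → S* (λ u → solUnitΣ d (α ⊝ y ⊗ v ⊝ x ⊗ u) (β ⊝ v ⊝ u))) ∎
    where open ≡-Reasoning
  solUnitΣ-perm (Perm.trans p p′) α β = trans (solUnitΣ-perm p α β) (solUnitΣ-perm p′ α β)

  solUnitΣ-translate : ∀ c l α β →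
    solUnitΣ c α β ≡ solUnitΣ (List.map (_⊝ l) c) (α ⊝ l ⊗ β) β
  solUnitΣ-translate [] l α β with β ≟ 0#
  ... | yes refl = cong (λ γ → ι (⌊ γ ≟ 0# ⌋ ∧ true))
                        (sym (trans (cong (α ⊝_) (R.zeroʳ l)) (⊝-identityʳ α)))
  ... | no _ = cong ι (trans (∧-zeroʳ _) (sym (∧-zeroʳ _)))
  solUnitΣ-translate (c ∷ cs) l α β = S*-cong (λ x _ →
    trans (solUnitΣ-translate cs l _ _)
          (cong (λ γ → solUnitΣ (List.map (_⊝ l) cs) γ (β ⊝ x)) (sym (translate-form α l β c x))))

  solUnitΣ-scale : ∀ c u → ¬ (u ≡ 0#) → ∀ α β → solUnitΣ c (u ⊗ α) (u ⊗ β) ≡ solUnitΣ c α β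
  solUnitΣ-scale [] u u≢0 α β rewrite ⊗≟0 u α u≢0 | ⊗≟0 u β u≢0 = refl
  solUnitΣ-scale (c ∷ cs) u u≢0 α β = begin
    S* (λ x → solUnitΣ cs (u ⊗ α ⊝ c ⊗ x) (u ⊗ β ⊝ x))
      ≡⟨ sym (S*-scale u u≢0 (λ x → solUnitΣ cs (u ⊗ α ⊝ c ⊗ x) (u ⊗ β ⊝ x))) ⟩
    S* (λ x → solUnitΣ cs (u ⊗ α ⊝ c ⊗ (u ⊗ x)) (u ⊗ β ⊝ u ⊗ x))
      ≡⟨ S*-cong (λ x _ → cong₂ (solUnitΣ cs) (scale-form u α c x) (sym (⊗-distrib-⊝ u β x))) ⟩
    S* (λ x → solUnitΣ cs (u ⊗ (α ⊝ c ⊗ x)) (u ⊗ (β ⊝ x)))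
      ≡⟨ S*-cong (λ x _ → solUnitΣ-scale cs u u≢0 _ _) ⟩
    S* (λ x → solUnitΣ cs (α ⊝ c ⊗ x) (β ⊝ x)) ∎
    where open ≡-Reasoning

  solUnitΣ-zeros : ∀ r d α β →
    solUnitΣ (List.replicate r 0# ++ d) α β ≡ S (λ γ → D r (β ⊝ γ) * solUnitΣ d α γ)
  solUnitΣ-zeros zero d α β = sym (trans (S-cong pointwise) (S-select β (solUnitΣ d α)))
    where
    pointwise : ∀ γ → D 0 (β ⊝ γ) * solUnitΣ d α γ ≡ (if ⌊ γ ≟ β ⌋ then solUnitΣ d α γ else 0)
    pointwise γ rewrite ⌊⌋-yes (0# ≟ 0#) refl
                      | ⌊⌋-⇔ ((β ⊝ γ) ≟ 0#) (γ ≟ β) (λ e → sym (⊝≡0⇒≡ β γ e))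
                                                    (λ { refl → ⊝-self γ })
                      with ⌊ γ ≟ β ⌋
    ... | true = ℕP.+-identityʳ _
    ... | false = refl
  solUnitΣ-zeros (suc r) d α β = begin
    S* (λ x → solUnitΣ (List.replicate r 0# ++ d) (α ⊝ 0# ⊗ x) (β ⊝ x))
      ≡⟨ S*-cong (λ x _ → solUnitΣ-zeros r d _ _) ⟩
    S* (λ x → S (λ γ → D r (β ⊝ x ⊝ γ) * solUnitΣ d (α ⊝ 0# ⊗ x) γ))
      ≡⟨ S*-cong (λ x _ → S-cong (λ γ → cong₂ (λ δ α′ → D r δ * solUnitΣ d α′ γ) (⊝-swap β x γ) (⊝-0⊗ α x))) ⟩
    S* (λ x → S (λ γ → D r (β ⊝ γ ⊝ x) * solUnitΣ d α γ))
      ≡⟨ sym (S-S*-swap (λ γ x → D r (β ⊝ γ ⊝ x) * solUnitΣ d α γ)) ⟩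
    S (λ γ → S* (λ x → D r (β ⊝ γ ⊝ x) * solUnitΣ d α γ))
      ≡⟨ S-cong (λ γ → trans (S*-cong (λ x _ → ℕP.*-comm _ (solUnitΣ d α γ)))
                      (trans (S*-* (solUnitΣ d α γ) _) (ℕP.*-comm (solUnitΣ d α γ) _))) ⟩
    S (λ γ → S* (λ x → D r (β ⊝ γ ⊝ x)) * solUnitΣ d α γ)
      ≡⟨ S-cong (λ γ → cong (_* solUnitΣ d α γ) (sym (D-suc r (β ⊝ γ)))) ⟩
    S (λ γ → D (suc r) (β ⊝ γ) * solUnitΣ d α γ) ∎
    where open ≡-Reasoning

  D-unit : ∀ r δ → ¬ (δ ≡ 0#) → D r δ ≡ D r 1#
  D-unit r δ δ≢0 = trans (cong₂ (solUnitΣ (List.replicate r 0#)) (sym (R.zeroʳ δ)) (sym (R.*-identityʳ δ)))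
                         (solUnitΣ-scale (List.replicate r 0#) δ δ≢0 0# 1#)

  -- Letting the first coordinate also be 0: D_{r+1} δ + D_r δ = Σ_{x ∈ F} D_r (δ - x),
  -- which does not depend on δ.
  D-rec : ∀ r δ → D (suc r) δ + D r δ ≡ S (D r)
  D-rec r δ = begin
    D (suc r) δ + D r δ                           ≡⟨ cong₂ _+_ (D-suc r δ) (cong (D r) (sym (⊝-identityʳ δ))) ⟩
    S* (λ x → D r (δ ⊝ x)) + D r (δ ⊝ 0#)       ≡⟨ ℕP.+-comm _ (D r (δ ⊝ 0#)) ⟩
    D r (δ ⊝ 0#) + S* (λ x → D r (δ ⊝ x))       ≡⟨ sym (S-split0 (λ x → D r (δ ⊝ x))) ⟩
    S (λ x → D r (δ ⊝ x))                        ≡⟨ S-transl δ (D r) ⟩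
    S (D r)                                       ∎
    where open ≡-Reasoning

  -- D r 0 = D r 1 + (-1)^r: the two sides of D-rec agree at δ = 0 and δ = 1.
  D-sign : ∀ r → + D r 0# ≡ + D r 1# ℤ.+ sgn F r
  D-sign zero rewrite ⌊⌋-yes (0# ≟ 0#) refl | ⌊⌋-no (1# ≟ 0#) (λ e → 0≢1 (sym e)) = refl
  D-sign (suc r) = begin
    + a′                       ≡⟨ add-sub (+ a′) (+ a) ⟩
    (+ a′ ℤ.+ + a) ℤ.- + a     ≡⟨ cong₂ ℤ._-_ sums-agree (D-sign r) ⟩
    (+ b′ ℤ.+ + b) ℤ.- (+ b ℤ.+ sgn F r) ≡⟨ regroup (+ b′) (+ b) (sgn F r) ⟩
    + b′ ℤ.+ sgn F (suc r)     ∎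
    where
    open ≡-Reasoning
    a′ = D (suc r) 0#
    a = D r 0#
    b′ = D (suc r) 1#
    b = D r 1#
    sums-agree : + a′ ℤ.+ + a ≡ + b′ ℤ.+ + b
    sums-agree = trans (sym (ℤP.pos-+ a′ a))
      (trans (cong +_ (trans (D-rec r 0#) (sym (D-rec r 1#)))) (ℤP.pos-+ b′ b))
    add-sub : ∀ (x y : ℤ) → x ≡ (x ℤ.+ y) ℤ.- y
    add-sub = solve-∀
    regroup : ∀ (x y z : ℤ) → (x ℤ.+ y) ℤ.- (y ℤ.+ z) ≡ x ℤ.+ (ℤ.- (+ 1)) ℤ.* z
    regroup = solve-∀

  S-solUnitΣ : ∀ c α → S (solUnitΣ c α) ≡ solUnit c α
  S-solUnitΣ [] α with α ≟ 0#
  ... | yes _ = S-select 0# (λ _ → 1)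
  ... | no _ = trans (S-const 0) (ℕP.*-zeroʳ q)
  S-solUnitΣ (c ∷ cs) α = begin
    S (λ β → S* (λ x → solUnitΣ cs (α ⊝ c ⊗ x) (β ⊝ x)))
      ≡⟨ S-S*-swap (λ β x → solUnitΣ cs (α ⊝ c ⊗ x) (β ⊝ x)) ⟩
    S* (λ x → S (λ β → solUnitΣ cs (α ⊝ c ⊗ x) (β ⊝ x)))
      ≡⟨ S*-cong (λ x _ → S-shift x (solUnitΣ cs (α ⊝ c ⊗ x))) ⟩
    S* (λ x → S (solUnitΣ cs (α ⊝ c ⊗ x)))
      ≡⟨ S*-cong (λ x _ → S-solUnitΣ cs _) ⟩
    S* (λ x → solUnit cs (α ⊝ c ⊗ x)) ∎
    where open ≡-Reasoning

  isZero isUnit : C → Bool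
  isZero y = ⌊ y ≟ 0# ⌋
  isUnit y = if ⌊ y ≟ 0# ⌋ then false else true

  count : (C → Bool) → List C → ℕ
  count p [] = 0
  count p (v ∷ c) = ι (p v) + count p c

  -- Zero coefficients leave their variable free in F*; the others can be
  -- scaled away, leaving Σ y = α in the remaining unit variables.
  solUnit-value : ∀ c α → solUnit c α ≡ (q ∸ 1) ^ count isZero c * D (count isUnit c) α
  solUnit-value [] α rewrite ⌊⌋-yes (0# ≟ 0#) refl = sym (ℕP.+-identityʳ _)
  solUnit-value (c ∷ cs) α with c ≟ 0#
  ... | yes refl = begin
    S* (λ x → solUnit cs (α ⊝ 0# ⊗ x))               ≡⟨ S*-cong (λ x _ → cong (solUnit cs) (⊝-0⊗ α x)) ⟩
    S* (λ _ → solUnit cs α)                          ≡⟨ S*-const _ ⟩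
    (q ∸ 1) * solUnit cs α                           ≡⟨ cong ((q ∸ 1) *_) (solUnit-value cs α) ⟩
    (q ∸ 1) * ((q ∸ 1) ^ count isZero cs * D (count isUnit cs) α) ≡⟨ sym (ℕP.*-assoc (q ∸ 1) _ _) ⟩
    (q ∸ 1) ^ suc (count isZero cs) * D (count isUnit cs) α ∎
    where open ≡-Reasoning
  ... | no c≢0 = begin
    S* (λ x → solUnit cs (α ⊝ c ⊗ x))
      ≡⟨ S*-cong (λ x _ → solUnit-value cs _) ⟩
    S* (λ x → Z * D n (α ⊝ c ⊗ x))
      ≡⟨ S*-* Z (λ x → D n (α ⊝ c ⊗ x)) ⟩
    Z * S* (λ x → D n (α ⊝ c ⊗ x))
      ≡⟨ cong (Z *_) (S*-scale c c≢0 (λ y → D n (α ⊝ y))) ⟩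
    Z * S* (λ y → D n (α ⊝ y))
      ≡⟨ cong (Z *_) (sym (D-suc n α)) ⟩
    Z * D (suc n) α ∎
    where
    open ≡-Reasoning
    Z = (q ∸ 1) ^ count isZero cs
    n = count isUnit cs

  solAll-total : ∀ c → S (solAll c) ≡ q ^ List.length c
  solAll-total [] = S-select 0# (λ _ → 1)
  solAll-total (c ∷ cs) = begin
    S (λ α → S (λ x → solAll cs (α ⊝ c ⊗ x))) ≡⟨ S-swap _ ⟩
    S (λ x → S (λ α → solAll cs (α ⊝ c ⊗ x))) ≡⟨ S-cong (λ x → S-shift (c ⊗ x) (solAll cs)) ⟩
    S (λ x → S (solAll cs))                   ≡⟨ S-const _ ⟩
    q * S (solAll cs)                         ≡⟨ cong (q *_) (solAll-total cs) ⟩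
    q * q ^ List.length cs                    ∎
    where open ≡-Reasoning

  solAll-value : ∀ c → Any (λ v → ¬ (v ≡ 0#)) c → ∀ α → solAll c α ≡ q ^ (List.length c ∸ 1)
  solAll-value (c ∷ cs) (here c≢0) α = begin
    S (λ x → solAll cs (α ⊝ c ⊗ x)) ≡⟨ S-scale c c≢0 (λ y → solAll cs (α ⊝ y)) ⟩
    S (λ y → solAll cs (α ⊝ y))     ≡⟨ S-transl α (solAll cs) ⟩
    S (solAll cs)                   ≡⟨ solAll-total cs ⟩
    q ^ List.length cs              ∎
    where open ≡-Reasoning
  solAll-value (c ∷ c′ ∷ cs) (there p) α = begin
    S (λ x → solAll (c′ ∷ cs) (α ⊝ c ⊗ x)) ≡⟨ S-cong (λ x → solAll-value (c′ ∷ cs) p _) ⟩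
    S (λ _ → q ^ List.length cs)           ≡⟨ S-const _ ⟩
    q * q ^ List.length cs                 ∎
    where open ≡-Reasoning

  countVec-unitHead : ∀ m (R : C → Vec C m → Bool) (g : C → ℕ) →
    (∀ c → ¬ (c ≡ 0#) → countVec F m (R c) ≡ g c) →
    S (λ c → countVec F m (λ v → isUnit c ∧ R c v)) ≡ S* g
  countVec-unitHead m R g e = trans (S-cong pointwise) (sym (S*-def g))
    where
    pointwise : ∀ c → countVec F m (λ v → isUnit c ∧ R c v) ≡ onUnits g c
    pointwise c with c ≟ 0#
    ... | yes _ = trans (countVec-const m false) (ℕP.*-zeroʳ (q ^ m))
    ... | no c≢0 = e c c≢0

  ∧-unit-first : ∀ a b c → (a ∧ (b ∧ c)) ≡ (b ∧ (a ∧ c))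
  ∧-unit-first true b c = refl
  ∧-unit-first false true c = refl
  ∧-unit-first false false c = refl

  sumCount-D : ∀ m β → countVec F m (λ y → ⌊ Vec.foldr _ _⊕_ 0# y ≟ β ⌋ ∧ allNonzero F y) ≡ D m β
  sumCount-D zero β rewrite ⌊⌋-yes (0# ≟ 0#) refl | ∧-identityʳ ⌊ 0# ≟ β ⌋ = cong ι (≟-sym 0# β)
  sumCount-D (suc m) β = begin
    _ ≡⟨ countVec-suc m (λ y → ⌊ Vec.foldr _ _⊕_ 0# y ≟ β ⌋ ∧ allNonzero F y) ⟩
    S (λ c → countVec F m (λ v → ⌊ (c ⊕ Vec.foldr _ _⊕_ 0# v) ≟ β ⌋ ∧ (isUnit c ∧ allNonzero F v)))
      ≡⟨ S-cong (λ c → countVec-cong m (λ v → ∧-unit-first _ (isUnit c) (allNonzero F v))) ⟩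
    S (λ c → countVec F m (λ v → isUnit c ∧ (⌊ (c ⊕ Vec.foldr _ _⊕_ 0# v) ≟ β ⌋ ∧ allNonzero F v)))
      ≡⟨ countVec-unitHead m _ (λ c → D m (β ⊝ c)) (λ c _ →
           trans (countVec-cong m (λ v → cong (_∧ allNonzero F v) (⊕≡-move c _ β))) (sumCount-D m (β ⊝ c))) ⟩
    S* (λ c → D m (β ⊝ c)) ≡⟨ sym (D-suc m β) ⟩
    D (suc m) β ∎
    where open ≡-Reasoning

  ψ≡D : ∀ m → ψ F m ≡ D m 0#
  ψ≡D m = sumCount-D m 0#

  φ≡D : ∀ m → φ F m ≡ D m 1#
  φ≡D m = sumCount-D m 1#

  form : ∀ n → (Fin n → C) → Vec C n → C
  form n c x = Σᶠ F n (λ i → c i ⊗ Vec.lookup x i)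

  total : ∀ n → Vec C n → C
  total n x = Σᶠ F n (λ i → Vec.lookup x i)

  countVec-solAll : ∀ n (c : Fin n → C) α →
    countVec F n (λ x → ⌊ form n c x ≟ α ⌋) ≡ solAll (List.tabulate c) α
  countVec-solAll zero c α = cong ι (≟-sym 0# α)
  countVec-solAll (suc n) c α = trans (countVec-suc n (λ x → ⌊ form (suc n) c x ≟ α ⌋))
    (S-cong (λ x → trans (countVec-cong n (λ v → ⊕≡-move _ _ α)) (countVec-solAll n (c ∘ Fin.suc) _)))

  countVec-solUnit : ∀ n (c : Fin n → C) α →
    countVec F n (λ x → ⌊ form n c x ≟ α ⌋ ∧ allNonzero F x) ≡ solUnit (List.tabulate c) α
  countVec-solUnit zero c α rewrite ∧-identityʳ ⌊ 0# ≟ α ⌋ = cong ι (≟-sym 0# α)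
  countVec-solUnit (suc n) c α = begin
    _ ≡⟨ countVec-suc n (λ x → ⌊ form (suc n) c x ≟ α ⌋ ∧ allNonzero F x) ⟩
    S (λ x → countVec F n (λ v → ⌊ (c Fin.zero ⊗ x ⊕ form n (c ∘ Fin.suc) v) ≟ α ⌋ ∧ (isUnit x ∧ allNonzero F v)))
      ≡⟨ S-cong (λ x → countVec-cong n (λ v → ∧-unit-first _ (isUnit x) (allNonzero F v))) ⟩
    S (λ x → countVec F n (λ v → isUnit x ∧ (⌊ (c Fin.zero ⊗ x ⊕ form n (c ∘ Fin.suc) v) ≟ α ⌋ ∧ allNonzero F v)))
      ≡⟨ countVec-unitHead n _ (λ x → solUnit (List.tabulate (c ∘ Fin.suc)) (α ⊝ c Fin.zero ⊗ x)) (λ x _ →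
           trans (countVec-cong n (λ v → cong (_∧ allNonzero F v) (⊕≡-move _ _ α)))
                 (countVec-solUnit n (c ∘ Fin.suc) _)) ⟩
    solUnit (List.tabulate c) α ∎
    where open ≡-Reasoning

  countVec-solUnitΣ : ∀ n (c : Fin n → C) α β →
    countVec F n (λ x → ⌊ form n c x ≟ α ⌋ ∧ (⌊ total n x ≟ β ⌋ ∧ allNonzero F x))
      ≡ solUnitΣ (List.tabulate c) α β
  countVec-solUnitΣ zero c α β rewrite ∧-identityʳ ⌊ 0# ≟ β ⌋ =
    cong₂ (λ a b → ι (a ∧ b)) (≟-sym 0# α) (≟-sym 0# β)
  countVec-solUnitΣ (suc n) c α β = begin
    _ ≡⟨ countVec-suc n (λ x → ⌊ form (suc n) c x ≟ α ⌋ ∧ (⌊ total (suc n) x ≟ β ⌋ ∧ allNonzero F x)) ⟩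
    S (λ x → countVec F n (λ v → a x v ∧ (b x v ∧ (isUnit x ∧ allNonzero F v))))
      ≡⟨ S-cong (λ x → countVec-cong n (λ v → unit-first (a x v) (b x v) (isUnit x) (allNonzero F v))) ⟩
    S (λ x → countVec F n (λ v → isUnit x ∧ (a x v ∧ (b x v ∧ allNonzero F v))))
      ≡⟨ countVec-unitHead n _ (λ x → solUnitΣ (List.tabulate (c ∘ Fin.suc)) (α ⊝ c Fin.zero ⊗ x) (β ⊝ x))
           (λ x _ → trans (countVec-cong n (λ v →
                             cong₂ (λ a b → a ∧ (b ∧ allNonzero F v)) (⊕≡-move _ _ α) (⊕≡-move x _ β)))
                           (countVec-solUnitΣ n (c ∘ Fin.suc) _ _)) ⟩
    solUnitΣ (List.tabulate c) α β ∎
    where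
    open ≡-Reasoning
    a b : C → Vec C n → Bool
    a x v = ⌊ (c Fin.zero ⊗ x ⊕ form n (c ∘ Fin.suc) v) ≟ α ⌋
    b x v = ⌊ (x ⊕ total n v) ≟ β ⌋
    unit-first : ∀ a b c d → (a ∧ (b ∧ (c ∧ d))) ≡ (c ∧ (a ∧ (b ∧ d)))
    unit-first a b c d = trans (cong (a ∧_) (∧-unit-first b c d)) (∧-unit-first a c (b ∧ d))

  -- N(c) = solUnitΣ c 0 0, the number of unit solutions of Σ c_i x_i = 0 = Σ x_i.
  -- After a block of r zero coefficients, split on whether Σ over the rest is 0.
  solUnitΣ-afterZeros : ∀ r d → solUnitΣ (List.replicate r 0# ++ d) 0# 0#
    ≡ D r 0# * solUnitΣ d 0# 0# + D r 1# * S* (solUnitΣ d 0#)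
  solUnitΣ-afterZeros r d = begin
    solUnitΣ (List.replicate r 0# ++ d) 0# 0#
      ≡⟨ solUnitΣ-zeros r d 0# 0# ⟩
    S (λ γ → D r (0# ⊝ γ) * solUnitΣ d 0# γ)
      ≡⟨ S-split0 (λ γ → D r (0# ⊝ γ) * solUnitΣ d 0# γ) ⟩
    D r (0# ⊝ 0#) * solUnitΣ d 0# 0# + S* (λ γ → D r (0# ⊝ γ) * solUnitΣ d 0# γ)
      ≡⟨ cong₂ _+_ (cong (λ δ → D r δ * solUnitΣ d 0# 0#) (⊝-self 0#))
                   (trans (S*-cong (λ γ γ≢0 → cong (_* solUnitΣ d 0# γ) (D-unit r (0# ⊝ γ) (nonzero γ γ≢0))))
                          (S*-* (D r 1#) (solUnitΣ d 0#))) ⟩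
    D r 0# * solUnitΣ d 0# 0# + D r 1# * S* (solUnitΣ d 0#) ∎
    where
    open ≡-Reasoning
    nonzero : ∀ γ → ¬ (γ ≡ 0#) → ¬ (0# ⊝ γ ≡ 0#)
    nonzero γ γ≢0 e = γ≢0 (sym (⊝≡0⇒≡ 0# γ e))

  -- With all coefficients units, N(d) together with the solutions of Σ x ≠ 0
  -- exhaust the unit solutions of Σ d_i x_i = 0, which number ψ_{|d|}.
  solUnitΣ-units : ∀ d → (∀ {v} → v ∈ d → ¬ (v ≡ 0#)) →
    solUnitΣ d 0# 0# + S* (solUnitΣ d 0#) ≡ D (List.length d) 0#
  solUnitΣ-units d units = begin
    solUnitΣ d 0# 0# + S* (solUnitΣ d 0#) ≡⟨ sym (S-split0 (solUnitΣ d 0#)) ⟩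
    S (solUnitΣ d 0#)                      ≡⟨ S-solUnitΣ d 0# ⟩
    solUnit d 0#                           ≡⟨ solUnit-value d 0# ⟩
    (q ∸ 1) ^ count isZero d * D (count isUnit d) 0#
      ≡⟨ cong₂ (λ z n → (q ∸ 1) ^ z * D n 0#) (no-zeros d units) (all-units d units) ⟩
    1 * D (List.length d) 0#               ≡⟨ ℕP.*-identityˡ _ ⟩
    D (List.length d) 0#                   ∎
    where
    open ≡-Reasoning
    no-zeros : ∀ d → (∀ {v} → v ∈ d → ¬ (v ≡ 0#)) → count isZero d ≡ 0
    no-zeros [] _ = refl
    no-zeros (v ∷ d) units rewrite ⌊⌋-no (v ≟ 0#) (units (here refl)) = no-zeros d (units ∘ there)
    all-units : ∀ d → (∀ {v} → v ∈ d → ¬ (v ≡ 0#)) → count isUnit d ≡ List.length d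
    all-units [] _ = refl
    all-units (v ∷ d) units rewrite ⌊⌋-no (v ≟ 0#) (units (here refl)) = cong suc (all-units d (units ∘ there))

  N-translate : ∀ g c → solUnitΣ c 0# 0# ≡ solUnitΣ (List.map (_⊝ g) c) 0# 0#
  N-translate g c = trans (solUnitΣ-translate c g 0# 0#) (cong (λ α → solUnitΣ (List.map (_⊝ g) c) α 0#) (0⊝⊗0 g))

  -- Subtracting g from all coefficients turns the block into zeros.
  block-step : ∀ r g d → (∀ {v} → v ∈ d → ¬ (v ≡ g)) →
    + solUnitΣ (List.replicate r g ++ d) 0# 0#
      ≡ + (ψ F (List.length d) * φ F r) ℤ.+ sgn F r ℤ.* + solUnitΣ d 0# 0#
  block-step r g d g∉d = begin
    + solUnitΣ (List.replicate r g ++ d) 0# 0#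
      ≡⟨ cong +_ (trans shifted (solUnitΣ-afterZeros r d′)) ⟩
    + (P * N₀ + Φ * Y)
      ≡⟨ trans (ℤP.pos-+ (P * N₀) (Φ * Y)) (cong₂ ℤ._+_ (ℤP.pos-* P N₀) (ℤP.pos-* Φ Y)) ⟩
    + P ℤ.* + N₀ ℤ.+ + Φ ℤ.* + Y
      ≡⟨ cong (λ z → z ℤ.* + N₀ ℤ.+ + Φ ℤ.* + Y) (D-sign r) ⟩
    (+ Φ ℤ.+ sgn F r) ℤ.* + N₀ ℤ.+ + Φ ℤ.* + Y
      ≡⟨ regroup (+ Φ) (sgn F r) (+ N₀) (+ Y) ⟩
    (+ N₀ ℤ.+ + Y) ℤ.* + Φ ℤ.+ sgn F r ℤ.* + N₀
      ≡⟨ cong₂ (λ u w → u ℤ.* + Φ ℤ.+ sgn F r ℤ.* + w)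
               (trans (sym (ℤP.pos-+ N₀ Y)) (cong +_ (solUnitΣ-units d′ units))) (sym (N-translate g d)) ⟩
    + D (List.length d′) 0# ℤ.* + Φ ℤ.+ sgn F r ℤ.* + solUnitΣ d 0# 0#
      ≡⟨ cong (ℤ._+ sgn F r ℤ.* + solUnitΣ d 0# 0#) ψφ ⟩
    + (ψ F (List.length d) * φ F r) ℤ.+ sgn F r ℤ.* + solUnitΣ d 0# 0# ∎
    where
    open ≡-Reasoning
    d′ = List.map (_⊝ g) d
    P = D r 0#
    Φ = D r 1#
    N₀ = solUnitΣ d′ 0# 0#
    Y = S* (solUnitΣ d′ 0#)
    shifted : solUnitΣ (List.replicate r g ++ d) 0# 0# ≡ solUnitΣ (List.replicate r 0# ++ d′) 0# 0#
    shifted = trans (N-translate g (List.replicate r g ++ d))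
      (cong (λ c → solUnitΣ c 0# 0#)
        (trans (ListP.map-++ (_⊝ g) (List.replicate r g) d)
               (cong (_++ d′) (trans (ListP.map-replicate (_⊝ g) r g) (cong (List.replicate r) (⊝-self g))))))
    units : ∀ {v} → v ∈ d′ → ¬ (v ≡ 0#)
    units v∈ with ∈P.∈-map⁻ (_⊝ g) v∈
    ... | (w , w∈d , refl) = λ e → g∉d w∈d (⊝≡0⇒≡ w g e)
    ψφ : + D (List.length d′) 0# ℤ.* + Φ ≡ + (ψ F (List.length d) * φ F r)
    ψφ = trans (sym (ℤP.pos-* (D (List.length d′) 0#) Φ)) (cong +_ (cong₂ _*_
      (trans (cong (λ n → D n 0#) (ListP.length-map (_⊝ g) d)) (sym (ψ≡D (List.length d)))) (sym (φ≡D r))))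
    regroup : ∀ (Φ s N Y : ℤ) → (Φ ℤ.+ s) ℤ.* N ℤ.+ Φ ℤ.* Y ≡ (N ℤ.+ Y) ℤ.* Φ ℤ.+ s ℤ.* N
    regroup = solve-∀

  cnt : C → List C → ℕ
  cnt g = count (λ v → ⌊ v ≟ g ⌋)

  without : C → List C → List C
  without g [] = []
  without g (v ∷ c) = if ⌊ v ≟ g ⌋ then without g c else v ∷ without g c

  gather : ∀ g c → c ↭ List.replicate (cnt g c) g ++ without g c
  gather g [] = Perm.refl
  gather g (v ∷ c) with v ≟ g
  ... | yes refl = Perm.prep v (gather v c)
  ... | no _ = Perm.trans (Perm.prep v (gather g c))
                          (Perm.↭-sym (PermP.shift v (List.replicate (cnt g c) g) (without g c)))

  length-gather : ∀ g c → List.length c ≡ cnt g c + List.length (without g c)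
  length-gather g c = trans (PermP.↭-length (gather g c))
    (trans (ListP.length-++ (List.replicate (cnt g c) g))
           (cong (_+ List.length (without g c)) (ListP.length-replicate (cnt g c))))

  without-∈ : ∀ g c {v} → v ∈ without g c → v ∈ c × ¬ (v ≡ g)
  without-∈ g (w ∷ c) v∈ with w ≟ g
  ... | yes _ = let (v∈c , v≢g) = without-∈ g c v∈ in there v∈c , v≢g
  without-∈ g (w ∷ c) (here refl) | no w≢g = here refl , w≢g
  without-∈ g (w ∷ c) (there v∈) | no _ = let (v∈c , v≢g) = without-∈ g c v∈ in there v∈c , v≢g

  cnt-without : ∀ g x c → ¬ (x ≡ g) → cnt x (without g c) ≡ cnt x c
  cnt-without g x [] _ = refl
  cnt-without g x (w ∷ c) x≢g with w ≟ g
  ... | yes refl rewrite ⌊⌋-no (w ≟ x) (λ e → x≢g (sym e)) = cnt-without w x c x≢g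
  ... | no _ = cong (_+_ (ι ⌊ w ≟ x ⌋)) (cnt-without g x c x≢g)

  without-all : ∀ g c → (∀ {v} → v ∈ c → v ≡ g) → without g c ≡ []
  without-all g [] _ = refl
  without-all g (w ∷ c) all-g rewrite all-g (here refl) | ⌊⌋-yes (g ≟ g) refl = without-all g c (all-g ∘ there)

  cnt-∈ : ∀ {v} c → v ∈ c → ¬ (cnt v c ≡ 0)
  cnt-∈ {v} (w ∷ c) (here refl) rewrite ⌊⌋-yes (v ≟ v) refl = λ ()
  cnt-∈ {v} (w ∷ c) (there v∈) with ⌊ w ≟ v ⌋
  ... | true = λ ()
  ... | false = cnt-∈ c v∈

  without-⊆ : ∀ g G c → (∀ {v} → v ∈ c → v ∈ g ∷ G) → ∀ {v} → v ∈ without g c → v ∈ G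
  without-⊆ g G c c⊆ v∈ with without-∈ g c v∈
  ... | (v∈c , v≢g) with c⊆ v∈c
  ...   | here v≡g = ⊥-elim (v≢g v≡g)
  ...   | there v∈G = v∈G

  cnt-without-all : ∀ g G c → All.All (λ x → ¬ (g ≡ x)) G →
    List.map (λ x → cnt x (without g c)) G ≡ List.map (λ x → cnt x c) G
  cnt-without-all g G c g∉G = ListP.map-cong-local (All.map (λ g≢x → cnt-without g _ c (λ e → g≢x (sym e))) g∉G)

  length-groups : ∀ G c → Unique G → (∀ {v} → v ∈ c → v ∈ G) →
    List.length c ≡ sum (List.map (λ x → cnt x c) G)
  length-groups [] [] _ _ = refl
  length-groups [] (v ∷ c) _ c⊆G with c⊆G (here refl)
  ... | ()
  length-groups (g ∷ G) c (g∉G ∷ uniq) c⊆G = begin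
    List.length c                                           ≡⟨ length-gather g c ⟩
    cnt g c + List.length (without g c)                     ≡⟨ cong (_+_ (cnt g c)) (length-groups G _ uniq (without-⊆ g G c c⊆G)) ⟩
    cnt g c + sum (List.map (λ x → cnt x (without g c)) G)  ≡⟨ cong (λ l → cnt g c + sum l) (cnt-without-all g G c g∉G) ⟩
    cnt g c + sum (List.map (λ x → cnt x c) G)              ∎
    where open ≡-Reasoning

  N[]≡1 : solUnitΣ [] 0# 0# ≡ 1
  N[]≡1 rewrite ⌊⌋-yes (0# ≟ 0#) refl = refl

  N-groups : ∀ g G c → Unique (g ∷ G) → (∀ {v} → v ∈ c → v ∈ g ∷ G) →
             + solUnitΣ c 0# 0# ≡ Arev F (List.map (λ x → cnt x c) (g ∷ G))
  N-groups g [] c _ c⊆g = begin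
    + solUnitΣ c 0# 0#
      ≡⟨ cong +_ (solUnitΣ-perm (gather g c) 0# 0#) ⟩
    + solUnitΣ (List.replicate r g ++ without g c) 0# 0#
      ≡⟨ cong (λ l → + solUnitΣ (List.replicate r g ++ l) 0# 0#) (without-all g c only-g) ⟩
    + solUnitΣ (List.replicate r g ++ []) 0# 0#
      ≡⟨ block-step r g [] (λ ()) ⟩
    + (ψ F 0 * φ F r) ℤ.+ sgn F r ℤ.* + solUnitΣ [] 0# 0#
      ≡⟨ cong₂ (λ u w → + (u * φ F r) ℤ.+ sgn F r ℤ.* + w) (trans (ψ≡D 0) N[]≡1) N[]≡1 ⟩
    + (1 * φ F r) ℤ.+ sgn F r ℤ.* + 1
      ≡⟨ cong₂ ℤ._+_ (cong +_ (trans (ℕP.*-identityˡ _) (φ≡D r))) (ℤP.*-identityʳ (sgn F r)) ⟩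
    + D r 1# ℤ.+ sgn F r
      ≡⟨ sym (D-sign r) ⟩
    + D r 0#
      ≡⟨ cong +_ (sym (ψ≡D r)) ⟩
    + ψ F r ∎
    where
    open ≡-Reasoning
    r = cnt g c
    only-g : ∀ {v} → v ∈ c → v ≡ g
    only-g v∈ with c⊆g v∈
    ... | here v≡g = v≡g
  N-groups g (g′ ∷ G) c (g∉ ∷ uniq) c⊆ = begin
    + solUnitΣ c 0# 0#
      ≡⟨ cong +_ (solUnitΣ-perm (gather g c) 0# 0#) ⟩
    + solUnitΣ (List.replicate r g ++ d) 0# 0#
      ≡⟨ block-step r g d (λ v∈ → proj₂ (without-∈ g c v∈)) ⟩
    + (ψ F (List.length d) * φ F r) ℤ.+ sgn F r ℤ.* + solUnitΣ d 0# 0#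
      ≡⟨ cong₂ (λ n z → + (ψ F n * φ F r) ℤ.+ sgn F r ℤ.* z) length-d (N-groups g′ G d uniq d⊆) ⟩
    + (ψ F (sum (mults c)) * φ F r) ℤ.+ sgn F r ℤ.* Arev F (mults d)
      ≡⟨ cong (λ l → + (ψ F (sum (mults c)) * φ F r) ℤ.+ sgn F r ℤ.* Arev F l) (cnt-without-all g _ c g∉) ⟩
    Arev F (List.map (λ x → cnt x c) (g ∷ g′ ∷ G)) ∎
    where
    open ≡-Reasoning
    r = cnt g c
    d = without g c
    mults : List C → List ℕ
    mults e = List.map (λ x → cnt x e) (g′ ∷ G)
    d⊆ : ∀ {v} → v ∈ d → v ∈ g′ ∷ G
    d⊆ = without-⊆ g (g′ ∷ G) c c⊆
    length-d : List.length d ≡ sum (mults c)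
    length-d = trans (length-groups (g′ ∷ G) d uniq d⊆) (cong sum (cnt-without-all g _ c g∉))

  N-groups′ : ∀ G c → Unique G → ¬ (G ≡ []) → (∀ {v} → v ∈ c → v ∈ G) →
              + solUnitΣ c 0# 0# ≡ Arev F (List.map (λ x → cnt x c) G)
  N-groups′ [] c _ G≢[] _ = ⊥-elim (G≢[] refl)
  N-groups′ (g ∷ G) c = λ uniq _ c⊆ → N-groups g G c uniq c⊆

  Arev-cons : ∀ t rest → ¬ (rest ≡ []) →
    Arev F (t ∷ rest) ≡ + (ψ F (sum rest) * φ F t) ℤ.+ sgn F t ℤ.* Arev F rest
  Arev-cons t [] rest≢[] = ⊥-elim (rest≢[] refl)
  Arev-cons t (_ ∷ _) _ = refl

  Σᶠ≡sum : ∀ n (f : Fin n → C) → Σᶠ F n f ≡ FΣ.sum f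
  Σᶠ≡sum zero f = refl
  Σᶠ≡sum (suc n) f = cong (f Fin.zero ⊕_) (Σᶠ≡sum n (f ∘ Fin.suc))

  count-tabulate : ∀ (p : C → Bool) n (f : Fin n → C) → count p (List.tabulate f) ≡ ∑ (λ i → ι (p (f i)))
  count-tabulate p zero f = refl
  count-tabulate p (suc n) f = cong (_+_ (ι (p (f Fin.zero)))) (count-tabulate p n (f ∘ Fin.suc))

  Π≟0 : ∀ n (y : Vec C n) → ⌊ Πᶠ F n (Vec.lookup y) ≟ 0# ⌋ ≡ not (allNonzero F y)
  Π≟0 zero [] = ⌊⌋-no (1# ≟ 0#) (λ e → 0≢1 (sym e))
  Π≟0 (suc n) (y₀ ∷ y) rewrite ⊗≟0-∨ y₀ (Πᶠ F n (Vec.lookup y)) | Π≟0 n y with ⌊ y₀ ≟ 0# ⌋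
  ... | true = refl
  ... | false = refl

  zeros+units : ∀ c → count isZero c + count isUnit c ≡ List.length c
  zeros+units [] = refl
  zeros+units (v ∷ c) with ⌊ v ≟ 0# ⌋
  ... | true = cong suc (zeros+units c)
  ... | false = trans (ℕP.+-suc _ _) (cong suc (zeros+units c))

  mult≡∑ : ∀ s (a : Fin s → C) v → mult F s a v ≡ ∑ (λ t → ι ⌊ a t ≟ v ⌋)
  mult≡∑ s a v = filtered s (λ t → t)
    where
    filtered : ∀ n (g : Fin n → Fin s) →
      List.length (List.filter (λ t → a t ≟ v) (List.tabulate g)) ≡ ∑ (λ i → ι ⌊ a (g i) ≟ v ⌋)
    filtered zero g = refl
    filtered (suc n) g with a (g Fin.zero) ≟ v
    ... | yes _ = cong suc (filtered n (g ∘ Fin.suc))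
    ... | no _ = filtered n (g ∘ Fin.suc)

  Σᶠ-cong : ∀ n {f g : Fin n → C} → (∀ i → f i ≡ g i) → Σᶠ F n f ≡ Σᶠ F n g
  Σᶠ-cong n {f} {g} e = trans (Σᶠ≡sum n f) (trans (FΣ.sum-cong-≗ e) (sym (Σᶠ≡sum n g)))

  Πᶠ-cong : ∀ n {f g : Fin n → C} → (∀ i → f i ≡ g i) → Πᶠ F n f ≡ Πᶠ F n g
  Πᶠ-cong zero e = refl
  Πᶠ-cong (suc n) e = cong₂ _⊗_ (e Fin.zero) (Πᶠ-cong n (e ∘ Fin.suc))

  mult-pos : ∀ s (a : Fin s → C) v → 1 ≤ mult F s a v → ∃[ t ] (a t ≡ v)
  mult-pos s a v pos with List.filter (λ t → a t ≟ v) (List.allFin s) in eq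
  mult-pos s a v () | []
  ... | t ∷ _ = t , proj₂ (∈P.∈-filter⁻ (λ t → a t ≟ v) {xs = List.allFin s} (subst (t ∈_) (sym eq) (here refl)))

  -- The coefficient vector (c_1,…,c_h) of Σ_t a_t x_{i_t}: c_{i_t} = a_t, and
  -- c_i = 0 at positions i not of the form i_t.
  module Coefficients (h s : ℕ) (idx : Fin s → Fin h) (a : Fin s → C)
                      (idx-inj : ∀ {t u} → idx t ≡ idx u → t ≡ u)
                      (a-unit : ∀ t → ¬ (a t ≡ 0#)) where

    hits : Fin s → Fin h → Bool
    hits t i = ⌊ idx t FinP.≟ i ⌋

    coeff : Fin h → C
    coeff i = FΣ.sum (λ t → if hits t i then a t else 0#)

    hits-at : ∀ t u → hits u (idx t) ≡ ⌊ u FinP.≟ t ⌋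
    hits-at t u = ⌊⌋-⇔ (idx u FinP.≟ idx t) (u FinP.≟ t) idx-inj (cong idx)

    coeff-idx : ∀ t → coeff (idx t) ≡ a t
    coeff-idx t = trans (∑ᶠ-single t _ off) (cong (λ b → if b then a t else 0#) (⌊⌋-yes (idx t FinP.≟ idx t) refl))
      where
      off : ∀ u → ¬ (u ≡ t) → (if hits u (idx t) then a u else 0#) ≡ 0#
      off u u≢t rewrite hits-at t u | ⌊⌋-no (u FinP.≟ t) u≢t = refl

    coeff-unused : ∀ i → (∀ t → ¬ (idx t ≡ i)) → coeff i ≡ 0#
    coeff-unused i unused =
      trans (FΣ.sum-cong-≗ off) (FΣ.sum-replicate-zero s)
      where
      off : ∀ t → (if hits t i then a t else 0#) ≡ 0#
      off t rewrite ⌊⌋-no (idx t FinP.≟ i) (unused t) = refl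

    coeff-cases : ∀ i → (∃[ t ] (idx t ≡ i)) ⊎ (∀ t → ¬ (idx t ≡ i))
    coeff-cases i with FinP.any? (λ t → idx t FinP.≟ i)
    ... | yes hit = inj₁ hit
    ... | no miss = inj₂ (λ t e → miss (t , e))

    coeff-form : ∀ (y : Vec C h) → Σᶠ F s (λ t → a t ⊗ Vec.lookup y (idx t)) ≡ form h coeff y
    coeff-form y = sym (begin
      Σᶠ F h (λ i → coeff i ⊗ y! i)
        ≡⟨ Σᶠ≡sum h _ ⟩
      FΣ.sum (λ i → coeff i ⊗ y! i)
        ≡⟨ FΣ.sum-cong-≗ (λ i → FΣ.*-distribʳ-sum (y! i) (λ t → if hits t i then a t else 0#)) ⟩
      FΣ.sum (λ i → FΣ.sum (λ t → (if hits t i then a t else 0#) ⊗ y! i))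
        ≡⟨ FΣ.∑-comm (λ i t → (if hits t i then a t else 0#) ⊗ y! i) ⟩
      FΣ.sum (λ t → FΣ.sum (λ i → (if hits t i then a t else 0#) ⊗ y! i))
        ≡⟨ FΣ.sum-cong-≗ (λ t → ∑ᶠ-single (idx t) _ (off t)) ⟩
      FΣ.sum (λ t → (if hits t (idx t) then a t else 0#) ⊗ y! (idx t))
        ≡⟨ FΣ.sum-cong-≗ (λ t → cong (λ b → (if b then a t else 0#) ⊗ y! (idx t)) (⌊⌋-yes (idx t FinP.≟ idx t) refl)) ⟩
      FΣ.sum (λ t → a t ⊗ y! (idx t))
        ≡⟨ sym (Σᶠ≡sum s _) ⟩
      Σᶠ F s (λ t → a t ⊗ y! (idx t)) ∎)
      where
      open ≡-Reasoning
      y! : Fin h → C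
      y! = Vec.lookup y
      off : ∀ t i → ¬ (i ≡ idx t) → (if hits t i then a t else 0#) ⊗ y! i ≡ 0#
      off t i i≢ rewrite ⌊⌋-no (idx t FinP.≟ i) (λ e → i≢ (sym e)) = R.zeroˡ (y! i)

    coeff-count : ∀ (p : C → Bool) → p 0# ≡ false → ∑ (λ i → ι (p (coeff i))) ≡ ∑ (λ t → ι (p (a t)))
    coeff-count p p0 = begin
      ∑ (λ i → ι (p (coeff i)))                                     ≡⟨ sum-cong-≗ spread ⟩
      ∑ (λ i → ∑ (λ t → if hits t i then ι (p (a t)) else 0))      ≡⟨ ∑-comm (λ i t → if hits t i then ι (p (a t)) else 0) ⟩
      ∑ (λ t → ∑ (λ i → if hits t i then ι (p (a t)) else 0))      ≡⟨ sum-cong-≗ (λ t → ∑-single (idx t) _ (off t)) ⟩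
      ∑ (λ t → if hits t (idx t) then ι (p (a t)) else 0)          ≡⟨ sum-cong-≗ (λ t → cong (λ b → if b then ι (p (a t)) else 0) (⌊⌋-yes (idx t FinP.≟ idx t) refl)) ⟩
      ∑ (λ t → ι (p (a t)))                                         ∎
      where
      open ≡-Reasoning
      off : ∀ t i → ¬ (i ≡ idx t) → (if hits t i then ι (p (a t)) else 0) ≡ 0
      off t i i≢ rewrite ⌊⌋-no (idx t FinP.≟ i) (λ e → i≢ (sym e)) = refl
      spread : ∀ i → ι (p (coeff i)) ≡ ∑ (λ t → if hits t i then ι (p (a t)) else 0)
      spread i with coeff-cases i
      ... | inj₁ (t , refl) = sym (trans (sum-cong-≗ (λ u → cong (λ b → if b then ι (p (a u)) else 0) (hits-at t u)))
                                         (trans (∑-select t (λ u → ι (p (a u)))) (cong (ι ∘ p) (sym (coeff-idx t)))))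
      ... | inj₂ unused = trans (cong (ι ∘ p) (coeff-unused i unused))
          (trans (cong ι p0) (sym (trans (sum-cong-≗ (λ t → cong (λ b → if b then ι (p (a t)) else 0)
                                                            (⌊⌋-no (idx t FinP.≟ i) (unused t))))
                                         (trans (∑-const s 0) (ℕP.*-zeroʳ s)))))

    clist : List C
    clist = List.tabulate coeff

    units-clist : count isUnit clist ≡ s
    units-clist = begin
      count isUnit clist          ≡⟨ count-tabulate isUnit h coeff ⟩
      ∑ (λ i → ι (isUnit (coeff i))) ≡⟨ coeff-count isUnit unit0 ⟩
      ∑ (λ t → ι (isUnit (a t)))  ≡⟨ sum-cong-≗ one ⟩
      ∑ (λ (t : Fin s) → 1)       ≡⟨ trans (∑-const s 1) (ℕP.*-identityʳ s) ⟩
      s                           ∎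
      where
      open ≡-Reasoning
      unit0 : isUnit 0# ≡ false
      unit0 rewrite ⌊⌋-yes (0# ≟ 0#) refl = refl
      one : ∀ t → ι (isUnit (a t)) ≡ 1
      one t rewrite ⌊⌋-no (a t ≟ 0#) (a-unit t) = refl

    zeros-clist : count isZero clist ≡ h ∸ s
    zeros-clist = begin
      count isZero clist                            ≡⟨ sym (ℕP.m+n∸n≡m _ s) ⟩
      count isZero clist + s ∸ s                    ≡⟨ cong (λ n → count isZero clist + n ∸ s) (sym units-clist) ⟩
      count isZero clist + count isUnit clist ∸ s   ≡⟨ cong (_∸ s) (trans (zeros+units clist) (ListP.length-tabulate coeff)) ⟩
      h ∸ s                                         ∎
      where open ≡-Reasoning

    cnt-clist : ∀ v → ¬ (v ≡ 0#) → cnt v clist ≡ mult F s a v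
    cnt-clist v v≢0 = trans (count-tabulate (λ x → ⌊ x ≟ v ⌋) h coeff)
      (trans (coeff-count (λ x → ⌊ x ≟ v ⌋) (⌊⌋-no (0# ≟ v) (λ e → v≢0 (sym e)))) (sym (mult≡∑ s a v)))

    clist-∈ : ∀ {v} → v ∈ clist → (v ≡ 0#) ⊎ (∃[ t ] (v ≡ a t))
    clist-∈ v∈ with ∈P.∈-tabulate⁻ v∈
    ... | (i , refl) with coeff-cases i
    ...   | inj₁ (t , refl) = inj₂ (t , coeff-idx t)
    ...   | inj₂ unused = inj₁ (coeff-unused i unused)

    Λ-event L0 L0* LΣ0* : Vec C h → Bool
    Λ-event y = ⌊ Σᶠ F s (λ t → a t ⊗ Vec.lookup y (idx t)) ≟ 0# ⌋
              ∧ ⌊ (total h y ⊗ Πᶠ F h (Vec.lookup y)) ≟ 0# ⌋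
    L0 y = ⌊ form h coeff y ≟ 0# ⌋
    L0* y = L0 y ∧ allNonzero F y
    LΣ0* y = L0 y ∧ (⌊ total h y ≟ 0# ⌋ ∧ allNonzero F y)

    Λ-restrict : ∀ k (h≤k : h ≤ k) → Λ F k h h≤k s idx a ≡ q ^ (k ∸ h) * countVec F h Λ-event
    Λ-restrict k h≤k = trans (countVec-cong k (λ x → cong₂ (λ u w → ⌊ u ≟ 0# ⌋ ∧ ⌊ w ≟ 0# ⌋)
        (Σᶠ-cong s (λ t → cong (a t ⊗_) (sym (VecP.lookup∘tabulate _ (idx t)))))
        (cong₂ _⊗_ (Σᶠ-cong h (λ i → sym (VecP.lookup∘tabulate _ i)))
                   (Πᶠ-cong h (λ i → sym (VecP.lookup∘tabulate _ i))))))
      (countVec-restrict h k h≤k Λ-event)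

    -- Inclusion–exclusion: (Σ y)·Π y = 0 iff Σ y = 0 or some y_i = 0.
    inclusion-exclusion : countVec F h Λ-event + countVec F h L0* ≡ countVec F h L0 + countVec F h LΣ0*
    inclusion-exclusion = countVec-add h Λ-event L0* L0 LΣ0* (λ y →
      trans (cong (λ e → ι e + ι (L0* y)) (event y)) (indicators (L0 y) ⌊ total h y ≟ 0# ⌋ (allNonzero F y)))
      where
      event : ∀ y → Λ-event y ≡ L0 y ∧ (⌊ total h y ≟ 0# ⌋ ∨ not (allNonzero F y))
      event y = cong₂ _∧_ (cong (λ u → ⌊ u ≟ 0# ⌋) (coeff-form y))
        (trans (⊗≟0-∨ (total h y) _) (cong (⌊ total h y ≟ 0# ⌋ ∨_) (Π≟0 h y)))
      indicators : ∀ p σ u → ι (p ∧ (σ ∨ not u)) + ι (p ∧ u) ≡ ι p + ι (p ∧ (σ ∧ u))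
      indicators false σ u = refl
      indicators true true true = refl
      indicators true true false = refl
      indicators true false true = refl
      indicators true false false = refl

    count-L0 : 1 ≤ s → countVec F h L0 ≡ q ^ (h ∸ 1)
    count-L0 1≤s = trans (countVec-solAll h coeff 0#)
      (trans (solAll-value clist (AnyP.tabulate⁺ (idx t₀) (λ e → a-unit t₀ (trans (sym (coeff-idx t₀)) e))) 0#)
             (cong (λ n → q ^ (n ∸ 1)) (ListP.length-tabulate coeff)))
      where
      t₀ : Fin s
      t₀ = Fin.fromℕ< 1≤s

    count-L0* : countVec F h L0* ≡ (q ∸ 1) ^ (h ∸ s) * ψ F s
    count-L0* = begin
      countVec F h L0*                                             ≡⟨ countVec-solUnit h coeff 0# ⟩
      solUnit clist 0#                                             ≡⟨ solUnit-value clist 0# ⟩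
      (q ∸ 1) ^ count isZero clist * D (count isUnit clist) 0#     ≡⟨ cong₂ (λ z n → (q ∸ 1) ^ z * D n 0#) zeros-clist units-clist ⟩
      (q ∸ 1) ^ (h ∸ s) * D s 0#                                   ≡⟨ cong ((q ∸ 1) ^ (h ∸ s) *_) (sym (ψ≡D s)) ⟩
      (q ∸ 1) ^ (h ∸ s) * ψ F s                                    ∎
      where open ≡-Reasoning

    count-LΣ0* : countVec F h LΣ0* ≡ solUnitΣ clist 0# 0#
    count-LΣ0* = countVec-solUnitΣ h coeff 0# 0#

    module Multiplicities (l : ℕ) (b : Fin l → C) (b-inj : Injective _≡_ _≡_ b)
                          (covered : ∀ t → ∃[ j ] (a t ≡ b j))
                          (r : Fin l → ℕ) (r-pos : ∀ j → 1 ≤ r j) (r-mult : ∀ j → r j ≡ mult F s a (b j))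
                          (1≤s : 1 ≤ s) where

      b-unit : ∀ j → ¬ (b j ≡ 0#)
      b-unit j with mult-pos s a (b j) (subst (1 ≤_) (r-mult j) (r-pos j))
      ... | (t , at≡bj) = λ bj≡0 → a-unit t (trans at≡bj bj≡0)

      cnt-b : ∀ j → cnt (b j) clist ≡ r j
      cnt-b j = trans (cnt-clist (b j) (b-unit j)) (sym (r-mult j))

      -- b_l, …, b_1: the order in which A consumes the multiplicities.
      bs : List C
      bs = List.reverse (List.tabulate b)

      bs-unique : Unique bs
      bs-unique = Unique-reverse (List.tabulate b) (UniqueP.tabulate⁺ b-inj)

      bs-mults : List.map (λ x → cnt x clist) bs ≡ List.reverse (toList r)
      bs-mults = trans (ListP.reverse-map _ (List.tabulate b))
        (cong List.reverse (trans (ListP.map-tabulate b _) (ListP.tabulate-cong cnt-b)))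

      nonempty : ∀ {A : Set} (f : Fin l → A) → ¬ (List.reverse (List.tabulate f) ≡ [])
      nonempty f e = Fin0-empty (subst Fin l≡0 (proj₁ (covered (Fin.fromℕ< 1≤s))))
        where
        l≡0 : l ≡ 0
        l≡0 = trans (sym (ListP.length-tabulate f))
                    (trans (sym (ListP.length-reverse (List.tabulate f))) (cong List.length e))
        Fin0-empty : Fin 0 → ⊥
        Fin0-empty ()

      0∉bs : ¬ (0# ∈ bs)
      0∉bs 0∈ with ∈P.∈-tabulate⁻ (AnyP.reverse⁻ 0∈)
      ... | (j , 0≡bj) = b-unit j (sym 0≡bj)

      clist-⊆ : ∀ {v} → v ∈ clist → (v ≡ 0#) ⊎ (v ∈ bs)
      clist-⊆ v∈ with clist-∈ v∈
      ... | inj₁ v≡0 = inj₁ v≡0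
      ... | inj₂ (t , refl) with covered t
      ...   | (j , at≡bj) = inj₂ (subst (_∈ bs) (sym at≡bj) (AnyP.reverse⁺ (∈P.∈-tabulate⁺ j)))

      -- N(c) = A_{r_1,…,r_l,h-s}: the value 0, of multiplicity h - s, is consumed last.
      N-clist : + solUnitΣ clist 0# 0# ≡ Aext F (toList r) (h ∸ s)
      N-clist = by-zeros (h ∸ s) zeros-clist
        where
        by-zeros : ∀ z → cnt 0# clist ≡ z → + solUnitΣ clist 0# 0# ≡ Aext F (toList r) z
        by-zeros zero no-zero = trans (N-groups′ bs clist bs-unique (nonempty b) ⊆bs) (cong (Arev F) bs-mults)
          where
          ⊆bs : ∀ {v} → v ∈ clist → v ∈ bs
          ⊆bs v∈ with clist-⊆ v∈
          ... | inj₁ refl = ⊥-elim (cnt-∈ clist v∈ no-zero)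
          ... | inj₂ v∈bs = v∈bs
        by-zeros (suc z) zeros = begin
          + solUnitΣ clist 0# 0#
            ≡⟨ N-groups 0# bs clist (AllP.¬Any⇒All¬ bs 0∉bs ∷ bs-unique) ⊆0bs ⟩
          Arev F (cnt 0# clist ∷ List.map (λ x → cnt x clist) bs)
            ≡⟨ cong₂ (λ t rest → Arev F (t ∷ rest)) zeros bs-mults ⟩
          Arev F (suc z ∷ List.reverse (toList r))
            ≡⟨ Arev-cons (suc z) (List.reverse (toList r)) (nonempty r) ⟩
          + (ψ F (sum (List.reverse (toList r))) * φ F (suc z)) ℤ.+ sgn F (suc z) ℤ.* A F (toList r)
            ≡⟨ cong (λ n → + (ψ F n * φ F (suc z)) ℤ.+ sgn F (suc z) ℤ.* A F (toList r)) (sum-reverse (toList r)) ⟩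
          Aext F (toList r) (suc z) ∎
          where
          open ≡-Reasoning
          ⊆0bs : ∀ {v} → v ∈ clist → v ∈ 0# ∷ bs
          ⊆0bs v∈ with clist-⊆ v∈
          ... | inj₁ v≡0 = here v≡0
          ... | inj₂ v∈bs = there v∈bs

increasing⇒injective : ∀ {m n} (f : Fin m → Fin n) → (∀ t u → t Fin.< u → f t Fin.< f u) →
                       ∀ {t u} → f t ≡ f u → t ≡ u
increasing⇒injective f increasing {t} {u} e with FinP.<-cmp t u
... | tri< t<u _ _ = ⊥-elim (FinP.<-irrefl e (increasing t u t<u))
... | tri≈ _ t≡u _ = t≡u
... | tri> _ _ u<t = ⊥-elim (FinP.<-irrefl (sym e) (increasing u t u<t))

scaled-solve : ∀ Q L M U N → L + M ≡ U + N →
               + (Q * L) ≡ (+ (Q * U) ℤ.- + (Q * M)) ℤ.+ + Q ℤ.* + N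
scaled-solve Q L M U N e = begin
  + (Q * L)                          ≡⟨ ℤP.pos-* Q L ⟩
  + Q ℤ.* + L                        ≡⟨ cong (+ Q ℤ.*_) (solve-for (+ L) (+ M)) ⟩
  + Q ℤ.* ((+ L ℤ.+ + M) ℤ.- + M)     ≡⟨ cong (λ z → + Q ℤ.* (z ℤ.- + M)) sums ⟩
  + Q ℤ.* ((+ U ℤ.+ + N) ℤ.- + M)     ≡⟨ distribute (+ Q) (+ U) (+ N) (+ M) ⟩
  (+ Q ℤ.* + U ℤ.- + Q ℤ.* + M) ℤ.+ + Q ℤ.* + N
    ≡⟨ cong₂ (λ x y → (x ℤ.- y) ℤ.+ + Q ℤ.* + N) (sym (ℤP.pos-* Q U)) (sym (ℤP.pos-* Q M)) ⟩
  (+ (Q * U) ℤ.- + (Q * M)) ℤ.+ + Q ℤ.* + N ∎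
  where
  open ≡-Reasoning
  sums : + L ℤ.+ + M ≡ + U ℤ.+ + N
  sums = trans (sym (ℤP.pos-+ L M)) (trans (cong +_ e) (ℤP.pos-+ U N))
  solve-for : ∀ (x y : ℤ) → x ≡ (x ℤ.+ y) ℤ.- y
  solve-for = solve-∀
  distribute : ∀ (x u n m : ℤ) → x ℤ.* ((u ℤ.+ n) ℤ.- m) ≡ (x ℤ.* u ℤ.- x ℤ.* m) ℤ.+ x ℤ.* n
  distribute = solve-∀

^-split : ∀ q {h k} → 1 ≤ h → h ≤ k → q ^ (k ∸ 1) ≡ q ^ (k ∸ h) * q ^ (h ∸ 1)
^-split q {h} {k} 1≤h h≤k = begin
  q ^ (k ∸ 1)               ≡⟨ cong (λ n → q ^ (n ∸ 1)) (sym (ℕP.m∸n+n≡m h≤k)) ⟩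
  q ^ (k ∸ h + h ∸ 1)       ≡⟨ cong (q ^_) (ℕP.+-∸-assoc (k ∸ h) 1≤h) ⟩
  q ^ (k ∸ h + (h ∸ 1))     ≡⟨ ℕP.^-distribˡ-+-* q (k ∸ h) (h ∸ 1) ⟩
  q ^ (k ∸ h) * q ^ (h ∸ 1) ∎
  where open ≡-Reasoning

proposition6 : (F : FiniteField) →
    IsPrimePower (FiniteField.size F) →
    (k h : ℕ) → 4 ≤ h → (h≤k : h ≤ k) →
    (s : ℕ) → 1 ≤ s → s ≤ h →
    (idx : Fin s → Fin h) → (∀ t u → t Fin.< u → idx t Fin.< idx u) →
    (a : Fin s → (FiniteField.Carrier F)) → (∀ t → ¬ (a t ≡ (FiniteField.0# F))) →
    (l : ℕ) → (b : Fin l → (FiniteField.Carrier F)) → Injective _≡_ _≡_ b →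
    (∀ t → ∃[ j ] (a t ≡ b j)) →
    (r : Fin l → ℕ) → (∀ j → 1 ≤ r j) → (∀ j → r j ≡ mult F s a (b j)) →
    + Λ F k h h≤k s idx a
      ≡ (+ ((FiniteField.size F) ^ (k ∸ 1)) ℤ.- + (((FiniteField.size F) ∸ 1) ^ (h ∸ s) * (FiniteField.size F) ^ (k ∸ h) * ψ F s))
        ℤ.+ + ((FiniteField.size F) ^ (k ∸ h)) ℤ.* Aext F (toList r) (h ∸ s)
proposition6 F _ k h 4≤h h≤k s 1≤s _ idx increasing a a-unit l b b-inj covered r r-pos r-mult = begin
  + Λ F k h h≤k s idx a
    ≡⟨ cong +_ (Λ-restrict k h≤k) ⟩
  + (Q * countVec F h Λ-event)
    ≡⟨ scaled-solve Q _ _ _ _ inclusion-exclusion ⟩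
  (+ (Q * countVec F h L0) ℤ.- + (Q * countVec F h L0*)) ℤ.+ + Q ℤ.* + countVec F h LΣ0*
    ≡⟨ cong₂ (λ U M → (+ (Q * U) ℤ.- + (Q * M)) ℤ.+ + Q ℤ.* + countVec F h LΣ0*) (count-L0 1≤s) count-L0* ⟩
  (+ (Q * q ^ (h ∸ 1)) ℤ.- + (Q * ((q ∸ 1) ^ (h ∸ s) * ψ F s))) ℤ.+ + Q ℤ.* + countVec F h LΣ0*
    ≡⟨ cong₂ (λ x y → (+ x ℤ.- + y) ℤ.+ + Q ℤ.* + countVec F h LΣ0*) (sym (^-split q 1≤h h≤k)) (reorder Q ((q ∸ 1) ^ (h ∸ s)) (ψ F s)) ⟩
  (+ (q ^ (k ∸ 1)) ℤ.- + ((q ∸ 1) ^ (h ∸ s) * Q * ψ F s)) ℤ.+ + Q ℤ.* + countVec F h LΣ0*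
    ≡⟨ cong (λ N → (+ (q ^ (k ∸ 1)) ℤ.- + ((q ∸ 1) ^ (h ∸ s) * Q * ψ F s)) ℤ.+ + Q ℤ.* N)
            (trans (cong +_ count-LΣ0*) N-clist) ⟩
  (+ (q ^ (k ∸ 1)) ℤ.- + ((q ∸ 1) ^ (h ∸ s) * Q * ψ F s)) ℤ.+ + Q ℤ.* Aext F (toList r) (h ∸ s) ∎
  where
  open ≡-Reasoning
  open Counting F
  open Coefficients h s idx a (increasing⇒injective idx increasing) a-unit
  open Multiplicities l b b-inj covered r r-pos r-mult 1≤s
  Q = q ^ (k ∸ h)
  1≤h : 1 ≤ h
  1≤h = ℕP.≤-trans (ℕ.s≤s ℕ.z≤n) 4≤h
  reorder : ∀ x y z → x * (y * z) ≡ y * x * z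
  reorder x y z = trans (sym (ℕP.*-assoc x y z)) (cong (_* z) (ℕP.*-comm x y))
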